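{- Let $y$ be arbitrary (a scalar or an indeterminate) and let $G$ be a finite graph. For every integer $k$, $$(\tau_{2,y})^k(G) = k^{c(G)}\,T_G(k+1,y),\qquad \left(\widetilde{\tau_{0,y}}\right)^k(G) = k^{c(G)}(-1)^{\mathrm{rk}(G)}\,T_G(1-k,y)$$ (with $0^0=1$). In particular, $(\widetilde{\tau_{0,y}})^{ -1}=\overline{\tau_{2,y}}$.
   Context: The graph algebra $\mathcal{G}$ (over a field of characteristic $0$ containing $y$) has basis the isomorphism classes of finite graphs (loops and multiple edges allowed), multiplication disjoint union, unit the empty graph, comultiplication $\Delta(G)=\sum_{T\subseteq V(G)}G|_T\otimes G|_{V(G)\setminus T}$ ($G|_T$ the induced subgraph), counit $\epsilon(G)=1$ if $G$ has no vertices, $0$ otherwise. Characters are multiplicative linear maps to the ground field; convolution is $(\phi*\psi)(G)=\sum_{T\subseteq V(G)}\phi(G|_T)\psi(G|_{V(G)\setminus T})$; $\phi^0=\epsilon$, $\phi^k$ is the $k$-fold convolution power for $k>0$, $\phi^{ -1}$ the convolution inverse and $\phi^k=(\phi^{ -1})^{ -k}$ for $k<0$. For $A\subseteq E(G)$, $\mathrm{rk}(A)$ is the size of a maximal acyclic subset of $A$, $\mathrm{nul}(A)=|A|-\mathrm{rk}(A)$, $\mathrm{rk}(G)=\mathrm{rk}(E(G))$, $n(G)$ the number of vertices and $c(G)$ the number of connected components. The Tutte polynomial is $T_G(x,y)=\sum_{A\subseteq E(G)}(x-1)^{\mathrm{rk}(G)-\mathrm{rk}(A)}(y-1)^{\mathrm{nul}(A)}$,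 and $\tau_{x,y}$ is the character $G\mapsto T_G(x,y)$. For a character $\phi$, $\bar\phi(G)=(-1)^{n(G)}\phi(G)$ and $\tilde\phi(G)=(-1)^{\mathrm{rk}(G)}\phi(G)$. -}

module Defs where

open import Level using (Level; _⊔_)
open import Data.Nat as ℕ using (ℕ; zero; suc; _∸_)
open import Data.Integer as ℤ using (ℤ; +_; -[1+_])
open import Data.Fin using (Fin; zero; suc; toℕ)
open import Data.Bool using (Bool; true; false; not; _∧_; _∨_; if_then_else_)
open import Data.Vec using (Vec; []; _∷_; map)
open import Data.List as L using (List; []; _∷_; _++_; mapMaybe; length; foldr)
open import Data.Maybe as M using (Maybe; just; nothing)
open import Data.Product using (_×_; _,_; ∃)
open import Relation.Nullary using (¬_)
open import Algebra.Bundles using (CommutativeRing)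

-- Finite (multi)graphs, loops and multiple edges allowed.
-- Vertices are Fin n; edges form a list (so parallel edges are distinct
-- list entries; a loop is an edge (v , v)).

record Graph : Set where
  constructor mkGraph
  field
    n     : ℕ
    edges : List (Fin n × Fin n)
open Graph public

allSubsets : (n : ℕ) → List (Vec Bool n)
allSubsets zero    = [] ∷ []
allSubsets (suc n) = L.map (true ∷_) (allSubsets n) ++ L.map (false ∷_) (allSubsets n)

count : ∀ {n} → Vec Bool n → ℕ
count []           = 0
count (true  ∷ S) = suc (count S)
count (false ∷ S) = count S

reindex : ∀ {n} (S : Vec Bool n) → Fin n → Maybe (Fin (count S))
reindex (true  ∷ S) zero    = just zero
reindex (true  ∷ S) (suc i) = M.map suc (reindex S i)
reindex (false ∷ S) zero    = nothing
reindex (false ∷ S) (suc i) = reindex S i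

induced : (G : Graph) → Vec Bool (n G) → Graph
induced G S = mkGraph (count S) (mapMaybe f (edges G))
  where
  f : Fin (n G) × Fin (n G) → Maybe (Fin (count S) × Fin (count S))
  f (u , v) = M.zipWith _,_ (reindex S u) (reindex S v)

complement : ∀ {n} → Vec Bool n → Vec Bool n
complement = map not

eqFin : ∀ {n} → Fin n → Fin n → Bool
eqFin i j = toℕ i ℕ.≡ᵇ toℕ j

anyL : ∀ {A : Set} → (A → Bool) → List A → Bool
anyL p = foldr (λ a b → p a ∨ b) false

reach : (G : Graph) → ℕ → Fin (n G) → Fin (n G) → Bool
reach G zero    i j = eqFin i j
reach G (suc k) i j = reach G k i j ∨
  anyL (λ { (u , v) → (reach G k i u ∧ eqFin v j) ∨ (reach G k i v ∧ eqFin u j) }) (edges G)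

connected : (G : Graph) → Fin (n G) → Fin (n G) → Bool
connected G = reach G (n G)

allFinL : (n : ℕ) → List (Fin n)
allFinL zero    = []
allFinL (suc n) = zero ∷ L.map suc (allFinL n)

countL : ∀ {A : Set} → (A → Bool) → List A → ℕ
countL p = foldr (λ a k → if p a then suc k else k) 0

-- c(G): number of vertices that are the least-indexed vertex of their component
c : Graph → ℕ
c G = countL (λ i → not (anyL (λ j → (toℕ j ℕ.<ᵇ toℕ i) ∧ connected G j i) (allFinL (n G))))
             (allFinL (n G))

-- Edge subsets A ⊆ E(G) (sub-multisets by position) and rank.

subLists : ∀ {A : Set} → List A → List (List A)
subLists []       = [] ∷ []
subLists (e ∷ es) = subLists es ++ L.map (e ∷_) (subLists es)

rkE : (G : Graph) → List (Fin (n G) × Fin (n G)) → ℕ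
rkE G A = n G ∸ c (mkGraph (n G) A)

rk : Graph → ℕ
rk G = rkE G (edges G)

nul : (G : Graph) → List (Fin (n G) × Fin (n G)) → ℕ
nul G A = length A ∸ rkE G A

module _ {a ℓ : Level} (R : CommutativeRing a ℓ) where
  open CommutativeRing R renaming (Carrier to K)

  pow : K → ℕ → K
  pow x zero    = 1#
  pow x (suc k) = x * pow x k

  fromℕ : ℕ → K
  fromℕ zero    = 0#
  fromℕ (suc k) = 1# + fromℕ k

  fromℤ : ℤ → K
  fromℤ (+ k)     = fromℕ k
  fromℤ -[1+ k ]  = - fromℕ (suc k)

  record IsFieldChar0 : Set (a ⊔ ℓ) where
    field
      nontrivial : ¬ (1# ≈ 0#)
      inverses   : ∀ x → ¬ (x ≈ 0#) → ∃ λ z → x * z ≈ 1#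
      char0      : ∀ k → ¬ (fromℕ (suc k) ≈ 0#)

  sumL : List K → K
  sumL = foldr _+_ 0#

  tutte : Graph → K → K → K
  tutte G x y = sumL (L.map (λ A → pow (x - 1#) (rk G ∸ rkE G A) * pow (y - 1#) (nul G A))
                            (subLists (edges G)))

  -- linear functionals on the graph algebra, given by values on graphs
  Fun : Set a
  Fun = Graph → K

  τ : K → K → Fun
  τ x y G = tutte G x y

  counit : Fun
  counit G with n G
  ... | zero  = 1#
  ... | suc _ = 0#

  conv : Fun → Fun → Fun
  conv φ ψ G = sumL (L.map (λ S → φ (induced G S) * ψ (induced G (complement S)))
                           (allSubsets (n G)))

  bar : Fun → Fun
  bar φ G = pow (- 1#) (n G) * φ G

  tilde : Fun → Fun
  tilde φ G = pow (- 1#) (rk G) * φ G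

  IsConvInverse : Fun → Fun → Set ℓ
  IsConvInverse φ ψ = ∀ G → (conv φ ψ G ≈ counit G) × (conv ψ φ G ≈ counit G)

  convPow : Fun → ℕ → Fun
  convPow φ zero    = counit
  convPow φ (suc k) = conv φ (convPow φ k)

  convPowℤ : Fun → Fun → ℤ → Fun
  convPowℤ φ φinv (+ k)    = convPow φ k
  convPowℤ φ φinv -[1+ m ] = convPow φinv (suc m)

module Submission where

-- Write Z q G = Σ_{A ⊆ E(G)} q^{c(V(G),A)} (y - 1)^{nul(A)}, which equals
-- q^{c(G)} T_G(q + 1, y).  The key identity is Z x * Z y = Z (x + y): a pair of
-- edge sets of G|_S and G|_{V∖S} is an edge set A of G with no edge between S
-- and V∖S, and for fixed A the sum over such S of x^{c(A|S)} y^{c(A|V∖S)} is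
-- (x + y)^{c(A)}, since S must be a union of components of A.  So q ↦ Z q is a
-- one-parameter group of characters with Z 0 the counit, whence (Z q)^k = Z (k q)
-- for all k ∈ ℤ.  Finally τ_{2,y} = Z 1 and the tilde of τ_{0,y} is the bar of
-- Z (-1); bar commutes with convolution, and convolution inverses are unique.

open import Defs
open import Level using (Level)
open import Function using (_∘_; id; Equivalence)
open import Data.Nat as ℕ using (ℕ; zero; suc; _∸_; _≤_; _<_; z≤n; s≤s)
import Data.Nat.Properties as ℕₚ
open import Data.Integer as ℤ using (ℤ; 1ℤ)
open import Data.Fin using (Fin; zero; suc; toℕ; cast)
open import Data.Fin.Properties using (toℕ-injective; toℕ<n)
import Data.Fin.Properties as Finₚ
open import Data.Bool using (Bool; true; false; not; _∧_; _∨_; if_then_else_)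
open import Data.Bool.Properties using (∧-comm; T-≡)
open import Data.Vec as V using (Vec; []; _∷_; _∷ʳ_; lookup; tabulate; replicate)
open import Data.Vec.Properties using (lookup∘tabulate)
open import Data.List as L using (List; []; _∷_; _++_; mapMaybe; length)
import Data.List.Properties as List
open import Data.List.Membership.Propositional using (_∈_)
open import Data.List.Membership.Propositional.Properties using (∈-map⁻; ∈-map⁺; ∈-++⁻)
open import Data.List.Relation.Unary.Any using (here; there)
open import Data.Maybe as M using (Maybe; just; nothing; is-just)
open import Data.Maybe.Properties using (just-injective)
open import Data.Product using (_×_; _,_; ∃; proj₁; proj₂)
open import Data.Sum using (_⊎_; inj₁; inj₂)
open import Data.Empty using (⊥; ⊥-elim)
open import Relation.Nullary using (¬_; yes; no)
open import Relation.Binary.PropositionalEquality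
  using (_≡_; _≢_; refl; sym; trans; cong; cong₂; subst; module ≡-Reasoning)
open import Relation.Binary.Definitions using (tri<; tri≈; tri>)
open import Algebra.Bundles using (CommutativeRing)

∨-true⁻ : ∀ a {b} → a ∨ b ≡ true → a ≡ true ⊎ b ≡ true
∨-true⁻ true  _ = inj₁ refl
∨-true⁻ false e = inj₂ e

∧-true⁻ : ∀ a {b} → a ∧ b ≡ true → a ≡ true × b ≡ true
∧-true⁻ true {true} _ = refl , refl

∨-true⁺ˡ : ∀ {a} b → a ≡ true → a ∨ b ≡ true
∨-true⁺ˡ b refl = refl

∨-true⁺ʳ : ∀ a {b} → b ≡ true → a ∨ b ≡ true
∨-true⁺ʳ true  _ = refl
∨-true⁺ʳ false e = e

true≢false : ∀ {b} → b ≡ true → b ≡ false → ⊥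
true≢false refl ()

not-true⁻ : ∀ {b} → not b ≡ true → b ≡ false
not-true⁻ {false} _ = refl

not-false⁻ : ∀ {b} → not b ≡ false → b ≡ true
not-false⁻ {true} _ = refl

true⇔⇒≡ : ∀ {a b} → (a ≡ true → b ≡ true) → (b ≡ true → a ≡ true) → a ≡ b
true⇔⇒≡ {true}  {true}  f g = refl
true⇔⇒≡ {true}  {false} f g = sym (f refl)
true⇔⇒≡ {false} {true}  f g = g refl
true⇔⇒≡ {false} {false} f g = refl

infix 4 _==_

_==_ : Bool → Bool → Bool
true  == b = b
false == b = not b

==⇒≡ : ∀ a b → (a == b) ≡ true → a ≡ b
==⇒≡ true  true  _ = refl
==⇒≡ false false _ = refl

≡⇒== : ∀ a b → a ≡ b → (a == b) ≡ true
≡⇒== true  _ refl = refl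
≡⇒== false _ refl = refl

module _ {A : Set} where

  anyL-true⁻ : (p : A → Bool) (xs : List A) → anyL p xs ≡ true → ∃ λ x → x ∈ xs × p x ≡ true
  anyL-true⁻ p (x ∷ xs) e with ∨-true⁻ (p x) e
  ... | inj₁ px = x , here refl , px
  ... | inj₂ r with anyL-true⁻ p xs r
  ...   | y , y∈xs , py = y , there y∈xs , py

  anyL-true⁺ : (p : A → Bool) {x : A} {xs : List A} → x ∈ xs → p x ≡ true → anyL p xs ≡ true
  anyL-true⁺ p {xs = y ∷ xs} (here refl) px = ∨-true⁺ˡ (anyL p xs) px
  anyL-true⁺ p {xs = y ∷ xs} (there x∈xs) px = ∨-true⁺ʳ (p y) (anyL-true⁺ p x∈xs px)

  anyL-cong : {p q : A → Bool} (xs : List A) → (∀ x → p x ≡ q x) → anyL p xs ≡ anyL q xs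
  anyL-cong []       p≗q = refl
  anyL-cong (x ∷ xs) p≗q = cong₂ _∨_ (p≗q x) (anyL-cong xs p≗q)

  countL-cong : {p q : A → Bool} (xs : List A) → (∀ x → p x ≡ q x) → countL p xs ≡ countL q xs
  countL-cong []       p≗q = refl
  countL-cong (x ∷ xs) p≗q rewrite p≗q x | countL-cong xs p≗q = refl

  countL-mono : {p q : A → Bool} (xs : List A) → (∀ x → p x ≡ true → q x ≡ true) →
    countL p xs ≤ countL q xs
  countL-mono [] p⇒q = z≤n
  countL-mono {p} {q} (x ∷ xs) p⇒q with p x in px | q x in qx
  ... | true  | true  = s≤s (countL-mono xs p⇒q)
  ... | false | true  = ℕₚ.m≤n⇒m≤1+n (countL-mono xs p⇒q)
  ... | false | false = countL-mono xs p⇒q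
  ... | true  | false = ⊥-elim (true≢false (p⇒q x px) qx)

  countL-mono-≡ : {p q : A → Bool} (xs : List A) → (∀ x → p x ≡ true → q x ≡ true) →
    countL p xs ≡ countL q xs → ∀ x → x ∈ xs → p x ≡ q x
  countL-mono-≡ {p} {q} (y ∷ xs) p⇒q eq x x∈ with p y in py | q y in qy
  countL-mono-≡ (y ∷ xs) p⇒q eq x (here refl) | true  | true  = trans py (sym qy)
  countL-mono-≡ (y ∷ xs) p⇒q eq x (here refl) | false | false = trans py (sym qy)
  countL-mono-≡ (y ∷ xs) p⇒q eq x (there x∈) | true  | true  =
    countL-mono-≡ xs p⇒q (ℕₚ.suc-injective eq) x x∈
  countL-mono-≡ (y ∷ xs) p⇒q eq x (there x∈) | false | false = countL-mono-≡ xs p⇒q eq x x∈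
  countL-mono-≡ (y ∷ xs) p⇒q eq x x∈ | true  | false = ⊥-elim (true≢false (p⇒q y py) qy)
  countL-mono-≡ (y ∷ xs) p⇒q eq x x∈ | false | true  =
    ⊥-elim (ℕₚ.<-irrefl eq (s≤s (countL-mono xs p⇒q)))

  countL-≤-length : (p : A → Bool) (xs : List A) → countL p xs ≤ length xs
  countL-≤-length p []       = z≤n
  countL-≤-length p (x ∷ xs) with p x
  ... | true  = s≤s (countL-≤-length p xs)
  ... | false = ℕₚ.m≤n⇒m≤1+n (countL-≤-length p xs)

  countL-all : (p : A → Bool) (xs : List A) → (∀ x → p x ≡ true) → countL p xs ≡ length xs
  countL-all p []       all = refl
  countL-all p (x ∷ xs) all rewrite all x = cong suc (countL-all p xs all)

  countL-none : (p : A → Bool) (xs : List A) → (∀ x → p x ≡ false) → countL p xs ≡ 0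
  countL-none p []       none = refl
  countL-none p (x ∷ xs) none rewrite none x = countL-none p xs none

  countL-pos : (p : A → Bool) {x : A} (xs : List A) → x ∈ xs → p x ≡ true → 1 ≤ countL p xs
  countL-pos p (y ∷ xs) (here refl) px rewrite px = s≤s z≤n
  countL-pos p (y ∷ xs) (there x∈) px with p y
  ... | true  = s≤s z≤n
  ... | false = countL-pos p xs x∈ px

  countL-partition : (h p : A → Bool) (xs : List A) →
    countL p xs ≡ countL (λ x → h x ∧ p x) xs ℕ.+ countL (λ x → not (h x) ∧ p x) xs
  countL-partition h p []       = refl
  countL-partition h p (x ∷ xs) with h x | p x
  ... | true  | true  = cong suc (countL-partition h p xs)
  ... | true  | false = countL-partition h p xs
  ... | false | true  = trans (cong suc (countL-partition h p xs)) (sym (ℕₚ.+-suc _ _))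
  ... | false | false = countL-partition h p xs

  countL-≤-+-difference : (p q : A → Bool) (xs : List A) →
    countL q xs ≤ countL p xs ℕ.+ countL (λ x → q x ∧ not (p x)) xs
  countL-≤-+-difference p q []       = z≤n
  countL-≤-+-difference p q (x ∷ xs) with p x | q x
  ... | true  | true  = s≤s (countL-≤-+-difference p q xs)
  ... | true  | false = ℕₚ.m≤n⇒m≤1+n (countL-≤-+-difference p q xs)
  ... | false | true  =
    ℕₚ.≤-trans (s≤s (countL-≤-+-difference p q xs)) (ℕₚ.≤-reflexive (sym (ℕₚ.+-suc _ _)))
  ... | false | false = countL-≤-+-difference p q xs

  countL-map : {B : Set} (f : B → A) (p : A → Bool) (xs : List B) →
    countL p (L.map f xs) ≡ countL (p ∘ f) xs
  countL-map f p []       = refl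
  countL-map f p (x ∷ xs) rewrite countL-map f p xs = refl

∈-allFinL : ∀ {m} (i : Fin m) → i ∈ allFinL m
∈-allFinL zero    = here refl
∈-allFinL (suc i) = there (∈-map⁺ suc (∈-allFinL i))

length-allFinL : ∀ m → length (allFinL m) ≡ m
length-allFinL zero    = refl
length-allFinL (suc m) = cong suc (trans (List.length-map suc (allFinL m)) (length-allFinL m))

countFin : ∀ {m} → (Fin m → Bool) → ℕ
countFin {m} p = countL p (allFinL m)

countFin-≤ : ∀ {m} (p : Fin m → Bool) → countFin p ≤ m
countFin-≤ {m} p = ℕₚ.≤-trans (countL-≤-length p (allFinL m)) (ℕₚ.≤-reflexive (length-allFinL m))

countFin-suc : ∀ {m} (p : Fin (suc m) → Bool) →
  countFin p ≡ (if p zero then suc (countFin (p ∘ suc)) else countFin (p ∘ suc))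
countFin-suc {m} p rewrite countL-map suc p (allFinL m) = refl

countFin-≤1 : ∀ {m} (p : Fin m → Bool) → (∀ i j → p i ≡ true → p j ≡ true → i ≡ j) → countFin p ≤ 1
countFin-≤1 {zero}  p unique = z≤n
countFin-≤1 {suc m} p unique rewrite countFin-suc p with p zero in p0
... | true  = s≤s (ℕₚ.≤-reflexive (countL-none _ (allFinL m) others-false))
  where
  others-false : ∀ i → p (suc i) ≡ false
  others-false i with p (suc i) in pi
  ... | false = refl
  ... | true  with unique zero (suc i) p0 pi
  ...   | ()
... | false = countFin-≤1 (p ∘ suc) (λ i j pi pj → Finₚ.suc-injective (unique (suc i) (suc j) pi pj))

eqFin⇒≡ : ∀ {m} (i j : Fin m) → eqFin i j ≡ true → i ≡ j
eqFin⇒≡ i j e = toℕ-injective (ℕₚ.≡ᵇ⇒≡ (toℕ i) (toℕ j) (Equivalence.from T-≡ e))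

eqFin-refl : ∀ {m} (i : Fin m) → eqFin i i ≡ true
eqFin-refl i = Equivalence.to T-≡ (ℕₚ.≡⇒≡ᵇ (toℕ i) (toℕ i) refl)

<ᵇ⇒< : ∀ {a b} → (a ℕ.<ᵇ b) ≡ true → a < b
<ᵇ⇒< {a} {b} e = ℕₚ.<ᵇ⇒< a b (Equivalence.from T-≡ e)

<⇒<ᵇ : ∀ {a b} → a < b → (a ℕ.<ᵇ b) ≡ true
<⇒<ᵇ a<b = Equivalence.to T-≡ (ℕₚ.<⇒<ᵇ a<b)

-- Walks and connectivity

Edges : ℕ → Set
Edges m = List (Fin m × Fin m)

Adjacent : ∀ {m} → Edges m → Fin m → Fin m → Set
Adjacent A u v = (u , v) ∈ A ⊎ (v , u) ∈ A

Adjacent-sym : ∀ {m} {A : Edges m} {u v} → Adjacent A u v → Adjacent A v u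
Adjacent-sym (inj₁ uv) = inj₂ uv
Adjacent-sym (inj₂ vu) = inj₁ vu

data Walk {m : ℕ} (A : Edges m) (x : Fin m) : Fin m → Set where
  []  : Walk A x x
  _▷_ : ∀ {u v} → Walk A x u → Adjacent A u v → Walk A x v

infixl 5 _▷_ _++ʷ_

_++ʷ_ : ∀ {m} {A : Edges m} {x y z} → Walk A x y → Walk A y z → Walk A x z
w ++ʷ []      = w
w ++ʷ (w′ ▷ a) = (w ++ʷ w′) ▷ a

reverseʷ : ∀ {m} {A : Edges m} {x y} → Walk A x y → Walk A y x
reverseʷ []      = []
reverseʷ (w ▷ a) = ([] ▷ Adjacent-sym a) ++ʷ reverseʷ w

edgeʷ : ∀ {m} {A : Edges m} {u v} → (u , v) ∈ A → Walk A u v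
edgeʷ uv = [] ▷ inj₁ uv

Walk-mono : ∀ {m} {A B : Edges m} → (∀ {e} → e ∈ A → e ∈ B) → ∀ {x y} → Walk A x y → Walk B x y
Walk-mono A⊆B []             = []
Walk-mono A⊆B (w ▷ inj₁ uv) = Walk-mono A⊆B w ▷ inj₁ (A⊆B uv)
Walk-mono A⊆B (w ▷ inj₂ vu) = Walk-mono A⊆B w ▷ inj₂ (A⊆B vu)

Walk-∅⇒≡ : ∀ {m} {x y : Fin m} → Walk [] x y → x ≡ y
Walk-∅⇒≡ []             = refl
Walk-∅⇒≡ (_ ▷ inj₁ ())
Walk-∅⇒≡ (_ ▷ inj₂ ())

module Reachability (m : ℕ) (A : Edges m) where

  private
    G : Graph
    G = mkGraph m A

  reach⇒Walk : ∀ k i j → reach G k i j ≡ true → Walk A i j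
  reach⇒Walk zero    i j e = subst (Walk A i) (eqFin⇒≡ i j e) []
  reach⇒Walk (suc k) i j e with ∨-true⁻ (reach G k i j) e
  ... | inj₁ r = reach⇒Walk k i j r
  ... | inj₂ r with anyL-true⁻ _ A r
  ...   | (u , v) , uv , last with ∨-true⁻ (reach G k i u ∧ eqFin v j) last
  ...     | inj₁ forward with ∧-true⁻ (reach G k i u) forward
  ...       | iu , v≡j = subst (Walk A i) (eqFin⇒≡ v j v≡j) (reach⇒Walk k i u iu ▷ inj₁ uv)
  reach⇒Walk (suc k) i j e | inj₂ r | (u , v) , uv , last | inj₂ backward
    with ∧-true⁻ (reach G k i v) backward
  ... | iv , u≡j = subst (Walk A i) (eqFin⇒≡ u j u≡j) (reach⇒Walk k i v iv ▷ inj₂ uv)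

  Walk⇒reach : ∀ {i j} → Walk A i j → ∃ λ k → reach G k i j ≡ true
  Walk⇒reach {i} [] = 0 , eqFin-refl i
  Walk⇒reach {i} (_▷_ {u} {v} w a) with Walk⇒reach w
  ... | k , r = suc k , ∨-true⁺ʳ (reach G k i v) (extend a)
    where
    reached : reach G k i u ∧ eqFin v v ≡ true
    reached = subst (λ b → b ∧ eqFin v v ≡ true) (sym r) (eqFin-refl v)
    extend : Adjacent A u v →
      anyL (λ { (s , t) → (reach G k i s ∧ eqFin t v) ∨ (reach G k i t ∧ eqFin s v) }) A ≡ true
    extend (inj₁ uv) = anyL-true⁺ _ uv (∨-true⁺ˡ _ reached)
    extend (inj₂ vu) = anyL-true⁺ _ vu (∨-true⁺ʳ _ reached)

  reach-+ : ∀ d k i j → reach G k i j ≡ true → reach G (d ℕ.+ k) i j ≡ true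
  reach-+ zero    k i j r = r
  reach-+ (suc d) k i j r = ∨-true⁺ˡ _ (reach-+ d k i j r)

  reach-suc-cong : ∀ k l i → (∀ j → reach G k i j ≡ reach G l i j) →
    ∀ j → reach G (suc k) i j ≡ reach G (suc l) i j
  reach-suc-cong k l i k≗l j = cong₂ _∨_ (k≗l j)
    (anyL-cong A λ { (u , v) → cong₂ _∨_ (cong (_∧ eqFin v j) (k≗l u)) (cong (_∧ eqFin u j) (k≗l v)) })

  -- The reachable sets from i grow strictly until they stabilise, so they
  -- stabilise after fewer than m steps.
  module Saturation (i : Fin m) where

    Stable : ℕ → Set
    Stable k = ∀ j → reach G (suc k) i j ≡ reach G k i j

    #reachable : ℕ → ℕ
    #reachable k = countFin (reach G k i)

    stable-or-grows : ∀ k → Stable k ⊎ #reachable k < #reachable (suc k)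
    stable-or-grows k with #reachable k ℕₚ.≟ #reachable (suc k)
    ... | yes eq = inj₁ λ j →
      sym (countL-mono-≡ (allFinL m) (λ j → ∨-true⁺ˡ _) eq j (∈-allFinL j))
    ... | no neq = inj₂ (ℕₚ.≤∧≢⇒< (countL-mono (allFinL m) (λ j → ∨-true⁺ˡ _)) neq)

    stable-before-or-exceeds : ∀ k → (∃ λ s → s < k × Stable s) ⊎ k < #reachable k
    stable-before-or-exceeds zero =
      inj₂ (countL-pos (reach G 0 i) (allFinL m) (∈-allFinL i) (eqFin-refl i))
    stable-before-or-exceeds (suc k) with stable-before-or-exceeds k
    ... | inj₁ (s , s<k , st) = inj₁ (s , ℕₚ.m<n⇒m<1+n s<k , st)
    ... | inj₂ k<#k with stable-or-grows k
    ...   | inj₁ st   = inj₁ (k , ℕₚ.≤-refl , st)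
    ...   | inj₂ grow = inj₂ (ℕₚ.<-≤-trans (s≤s k<#k) grow)

    stable-before-m : ∃ λ s → s < m × Stable s
    stable-before-m with stable-before-or-exceeds m
    ... | inj₁ found = found
    ... | inj₂ m<#m  = ⊥-elim (ℕₚ.<-irrefl refl (ℕₚ.<-≤-trans m<#m (countFin-≤ (reach G m i))))

    stable-forever : ∀ s → Stable s → ∀ d j → reach G (d ℕ.+ s) i j ≡ reach G s i j
    stable-forever s st zero    j = refl
    stable-forever s st (suc d) j = trans (reach-suc-cong (d ℕ.+ s) s i (stable-forever s st d) j) (st j)

    reach-saturates : ∀ k j → reach G k i j ≡ true → reach G m i j ≡ true
    reach-saturates k j r with stable-before-m
    ... | s , s<m , st = subst (λ l → reach G l i j ≡ true) (ℕₚ.m∸n+n≡m (ℕₚ.<⇒≤ s<m))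
            (reach-+ (m ∸ s) s i j reach-s)
      where
      reach-s : reach G s i j ≡ true
      reach-s = trans (sym (stable-forever s st k j))
                      (subst (λ l → reach G l i j ≡ true) (ℕₚ.+-comm s k) (reach-+ s k i j r))

  connected⇒Walk : ∀ i j → connected G i j ≡ true → Walk A i j
  connected⇒Walk i j = reach⇒Walk m i j

  Walk⇒connected : ∀ {i j} → Walk A i j → connected G i j ≡ true
  Walk⇒connected {i} {j} w with Walk⇒reach w
  ... | k , r = Saturation.reach-saturates i k j r

-- Components

isRoot : ∀ {m} → Edges m → Fin m → Bool
isRoot {m} A i = not (anyL (λ j → (toℕ j ℕ.<ᵇ toℕ i) ∧ connected (mkGraph m A) j i) (allFinL m))

-- c (mkGraph m A) unfolds to #components A
#components : ∀ {m} → Edges m → ℕ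
#components A = countFin (isRoot A)

rank : ∀ {m} → Edges m → ℕ
rank {m} A = m ∸ #components A

nullity : ∀ {m} → Edges m → ℕ
nullity A = length A ∸ rank A

isRoot⇒minimal : ∀ {m} (A : Edges m) i → isRoot A i ≡ true → ∀ j → toℕ j < toℕ i → ¬ Walk A j i
isRoot⇒minimal {m} A i root j j<i w = true≢false
  (anyL-true⁺ _ (∈-allFinL j) (cong₂ _∧_ (<⇒<ᵇ j<i) (Reachability.Walk⇒connected m A w)))
  (not-true⁻ root)

¬isRoot⇒smaller : ∀ {m} (A : Edges m) i → isRoot A i ≡ false → ∃ λ j → toℕ j < toℕ i × Walk A j i
¬isRoot⇒smaller {m} A i ¬root with anyL-true⁻ _ (allFinL m) (not-false⁻ ¬root)
... | j , _ , found with ∧-true⁻ (toℕ j ℕ.<ᵇ toℕ i) found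
...   | j<i , ji = j , <ᵇ⇒< j<i , Reachability.connected⇒Walk m A j i ji

minimal⇒isRoot : ∀ {m} (A : Edges m) i → (∀ j → toℕ j < toℕ i → ¬ Walk A j i) → isRoot A i ≡ true
minimal⇒isRoot A i minimal with isRoot A i in root
... | true  = refl
... | false with ¬isRoot⇒smaller A i root
...   | j , j<i , w = ⊥-elim (minimal j j<i w)

isRoot-antitone : ∀ {m} (A B : Edges m) → (∀ {e} → e ∈ A → e ∈ B) → ∀ i →
  isRoot B i ≡ true → isRoot A i ≡ true
isRoot-antitone A B A⊆B i root =
  minimal⇒isRoot A i (λ j j<i w → isRoot⇒minimal B i root j j<i (Walk-mono A⊆B w))

connected-roots-≡ : ∀ {m} (A : Edges m) a b → isRoot A a ≡ true → isRoot A b ≡ true → Walk A a b → a ≡ b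
connected-roots-≡ A a b ra rb w with ℕₚ.<-cmp (toℕ a) (toℕ b)
... | tri< a<b _ _ = ⊥-elim (isRoot⇒minimal A b rb a a<b w)
... | tri≈ _ a≡b _ = toℕ-injective a≡b
... | tri> _ _ b<a = ⊥-elim (isRoot⇒minimal A a ra b b<a (reverseʷ w))

isRoot-∅ : ∀ {m} (i : Fin m) → isRoot [] i ≡ true
isRoot-∅ i = minimal⇒isRoot [] i (λ j j<i w → ℕₚ.<-irrefl (cong toℕ (Walk-∅⇒≡ w)) j<i)

#components-∅ : ∀ m → #components {m} [] ≡ m
#components-∅ m = trans (countL-all _ (allFinL m) isRoot-∅) (length-allFinL m)

#components-≤ : ∀ {m} (A : Edges m) → #components A ≤ m
#components-≤ A = countFin-≤ (isRoot A)

#components-antitone : ∀ {m} (A B : Edges m) → (∀ {e} → e ∈ A → e ∈ B) → #components B ≤ #components A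
#components-antitone {m} A B A⊆B = countL-mono (allFinL m) (isRoot-antitone A B A⊆B)

#components-pos : ∀ {m} (A : Edges (suc m)) → 1 ≤ #components A
#components-pos A = countL-pos (isRoot A) (allFinL _) (here refl) (minimal⇒isRoot A zero (λ _ ()))

-- Adding the edge (u , v) merges at most two components: a root lost by adding
-- it is A-connected to u or to v, and two lost roots would be A-connected.
module AddEdge {m : ℕ} (A : Edges m) (u v : Fin m) where

  Through : Fin m → Fin m → Set
  Through x y = Walk A x y ⊎ (Walk A x u × Walk A v y ⊎ Walk A x v × Walk A u y)

  private
    extend : ∀ {x a b} → Through x a → Walk A a b → Through x b
    extend (inj₁ p)                q = inj₁ (p ++ʷ q)
    extend (inj₂ (inj₁ (p₁ , p₂))) q = inj₂ (inj₁ (p₁ , p₂ ++ʷ q))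
    extend (inj₂ (inj₂ (p₁ , p₂))) q = inj₂ (inj₂ (p₁ , p₂ ++ʷ q))

  split : ∀ {x y} → Walk ((u , v) ∷ A) x y → Through x y
  split [] = inj₁ []
  split (w ▷ inj₁ (there e)) = extend (split w) (edgeʷ e)
  split (w ▷ inj₂ (there e)) = extend (split w) (reverseʷ (edgeʷ e))
  split (w ▷ inj₁ (here refl)) with split w
  ... | inj₁ p                = inj₂ (inj₁ (p , []))
  ... | inj₂ (inj₁ (p₁ , p₂)) = inj₁ (p₁ ++ʷ reverseʷ p₂)
  ... | inj₂ (inj₂ (p₁ , _))  = inj₁ p₁
  split (w ▷ inj₂ (here refl)) with split w
  ... | inj₁ p                = inj₂ (inj₂ (p , []))
  ... | inj₂ (inj₁ (p₁ , _))  = inj₁ p₁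
  ... | inj₂ (inj₂ (p₁ , p₂)) = inj₁ (p₁ ++ʷ reverseʷ p₂)

  lostRoot : Fin m → Bool
  lostRoot i = isRoot A i ∧ not (isRoot ((u , v) ∷ A) i)

  private
    lostRoot⁻ : ∀ i → lostRoot i ≡ true →
      isRoot A i ≡ true × ∃ λ j → toℕ j < toℕ i × Walk ((u , v) ∷ A) j i
    lostRoot⁻ i lost with ∧-true⁻ (isRoot A i) lost
    ... | root , lost′ = root , ¬isRoot⇒smaller _ i (not-true⁻ lost′)

    lostRoot-near-edge : ∀ i → lostRoot i ≡ true → Walk A u i ⊎ Walk A v i
    lostRoot-near-edge i lost with lostRoot⁻ i lost
    ... | root , j , j<i , w with split w
    ...   | inj₁ w′               = ⊥-elim (isRoot⇒minimal A i root j j<i w′)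
    ...   | inj₂ (inj₁ (_ , vi)) = inj₂ vi
    ...   | inj₂ (inj₂ (_ , ui)) = inj₁ ui

    lostRoot-no-smaller : ∀ i₁ i₂ → lostRoot i₁ ≡ true → lostRoot i₂ ≡ true →
      toℕ i₁ < toℕ i₂ → ⊥
    lostRoot-no-smaller i₁ i₂ lost₁ lost₂ i₁<i₂ with lostRoot⁻ i₁ lost₁ | lostRoot⁻ i₂ lost₂
    ... | root₁ , j , j<i₁ , w | root₂ , _ = reach₂ (split w) (lostRoot-near-edge i₂ lost₂)
      where
      not-to-i₂ : ∀ {z} → toℕ z < toℕ i₂ → ¬ Walk A z i₂
      not-to-i₂ {z} = isRoot⇒minimal A i₂ root₂ z
      j<i₂ : toℕ j < toℕ i₂
      j<i₂ = ℕₚ.<-trans j<i₁ i₁<i₂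
      reach₂ : Through j i₁ → Walk A u i₂ ⊎ Walk A v i₂ → ⊥
      reach₂ (inj₁ w′)                  _         = isRoot⇒minimal A i₁ root₁ j j<i₁ w′
      reach₂ (inj₂ (inj₁ (ju , vi₁)))  (inj₁ ui₂) = not-to-i₂ j<i₂ (ju ++ʷ ui₂)
      reach₂ (inj₂ (inj₁ (ju , vi₁)))  (inj₂ vi₂) = not-to-i₂ i₁<i₂ (reverseʷ vi₁ ++ʷ vi₂)
      reach₂ (inj₂ (inj₂ (jv , ui₁)))  (inj₁ ui₂) = not-to-i₂ i₁<i₂ (reverseʷ ui₁ ++ʷ ui₂)
      reach₂ (inj₂ (inj₂ (jv , ui₁)))  (inj₂ vi₂) = not-to-i₂ j<i₂ (jv ++ʷ vi₂)

    lostRoot-unique : ∀ i j → lostRoot i ≡ true → lostRoot j ≡ true → i ≡ j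
    lostRoot-unique i j lostᵢ lostⱼ with ℕₚ.<-cmp (toℕ i) (toℕ j)
    ... | tri< i<j _ _ = ⊥-elim (lostRoot-no-smaller i j lostᵢ lostⱼ i<j)
    ... | tri≈ _ i≡j _ = toℕ-injective i≡j
    ... | tri> _ _ j<i = ⊥-elim (lostRoot-no-smaller j i lostⱼ lostᵢ j<i)

  #components-∷ : #components A ≤ suc (#components ((u , v) ∷ A))
  #components-∷ = ℕₚ.≤-trans (countL-≤-+-difference (isRoot ((u , v) ∷ A)) (isRoot A) (allFinL m))
    (ℕₚ.≤-trans (ℕₚ.+-monoʳ-≤ (#components ((u , v) ∷ A)) (countFin-≤1 lostRoot lostRoot-unique))
                (ℕₚ.≤-reflexive (ℕₚ.+-comm _ 1)))

≤-#components+length : ∀ {m} (A : Edges m) → m ≤ #components A ℕ.+ length A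
≤-#components+length {m} [] = ℕₚ.≤-reflexive (trans (sym (#components-∅ m)) (sym (ℕₚ.+-identityʳ _)))
≤-#components+length {m} ((u , v) ∷ A) = ℕₚ.≤-trans (≤-#components+length A)
  (ℕₚ.≤-trans (ℕₚ.+-monoˡ-≤ (length A) (AddEdge.#components-∷ A u v))
              (ℕₚ.≤-reflexive (sym (ℕₚ.+-suc _ (length A)))))

rank-≤-length : ∀ {m} (A : Edges m) → rank A ≤ length A
rank-≤-length {m} A = ℕₚ.≤-trans (ℕₚ.∸-monoˡ-≤ (#components A) (≤-#components+length A))
  (ℕₚ.≤-reflexive (ℕₚ.m+n∸m≡n (#components A) (length A)))

-- Induced subgraphs

restrictEdge : ∀ {m} (S : Vec Bool m) → Fin m × Fin m → Maybe (Fin (count S) × Fin (count S))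
restrictEdge S (u , v) = M.zipWith _,_ (reindex S u) (reindex S v)

-- edges (induced G S) unfolds to restrict S (edges G)
restrict : ∀ {m} (S : Vec Bool m) → Edges m → Edges (count S)
restrict S = mapMaybe (restrictEdge S)

embed : ∀ {m} (S : Vec Bool m) → Fin (count S) → Fin m
embed (true  ∷ S) zero    = zero
embed (true  ∷ S) (suc i) = suc (embed S i)
embed (false ∷ S) i       = suc (embed S i)

reindex-just⁻ : ∀ {m} (S : Vec Bool m) u {u′} → reindex S u ≡ just u′ →
  embed S u′ ≡ u × lookup S u ≡ true
reindex-just⁻ (true ∷ S) zero refl = refl , refl
reindex-just⁻ (true ∷ S) (suc u) e with reindex S u in e′
reindex-just⁻ (true ∷ S) (suc u) refl | just _ =
  cong suc (proj₁ (reindex-just⁻ S u e′)) , proj₂ (reindex-just⁻ S u e′)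
reindex-just⁻ (false ∷ S) (suc u) e = cong suc (proj₁ (reindex-just⁻ S u e)) , proj₂ (reindex-just⁻ S u e)

reindex-outside : ∀ {m} (S : Vec Bool m) u → lookup S u ≡ false → reindex S u ≡ nothing
reindex-outside (false ∷ S) zero    _ = refl
reindex-outside (true  ∷ S) (suc u) e rewrite reindex-outside S u e = refl
reindex-outside (false ∷ S) (suc u) e = reindex-outside S u e

reindex-inside : ∀ {m} (S : Vec Bool m) u → lookup S u ≡ true → ∃ λ u′ → reindex S u ≡ just u′
reindex-inside (true ∷ S) zero e = zero , refl
reindex-inside (true ∷ S) (suc u) e with reindex-inside S u e
... | u′ , eq rewrite eq = suc u′ , refl
reindex-inside (false ∷ S) (suc u) e = reindex-inside S u e

reindex-embed : ∀ {m} (S : Vec Bool m) i → reindex S (embed S i) ≡ just i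
reindex-embed (true  ∷ S) zero    = refl
reindex-embed (true  ∷ S) (suc i) rewrite reindex-embed S i = refl
reindex-embed (false ∷ S) i       = reindex-embed S i

embed-inside : ∀ {m} (S : Vec Bool m) i → lookup S (embed S i) ≡ true
embed-inside S i = proj₂ (reindex-just⁻ S (embed S i) (reindex-embed S i))

embed-onto : ∀ {m} (S : Vec Bool m) u → lookup S u ≡ true → ∃ λ u′ → embed S u′ ≡ u
embed-onto S u e with reindex-inside S u e
... | u′ , eq = u′ , proj₁ (reindex-just⁻ S u eq)

embed-injective : ∀ {m} (S : Vec Bool m) i j → embed S i ≡ embed S j → i ≡ j
embed-injective S i j e = just-injective (trans (sym (reindex-embed S i)) (trans (cong (reindex S) e) (reindex-embed S j)))

embed-mono : ∀ {m} (S : Vec Bool m) i j → toℕ i < toℕ j → toℕ (embed S i) < toℕ (embed S j)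
embed-mono (true  ∷ S) zero    (suc j) i<j       = s≤s z≤n
embed-mono (true  ∷ S) (suc i) (suc j) (s≤s i<j) = s≤s (embed-mono S i j i<j)
embed-mono (false ∷ S) i       j       i<j       = s≤s (embed-mono S i j i<j)

embed-mono⁻ : ∀ {m} (S : Vec Bool m) i j → toℕ (embed S i) < toℕ (embed S j) → toℕ i < toℕ j
embed-mono⁻ (true  ∷ S) zero    (suc j) _         = s≤s z≤n
embed-mono⁻ (true  ∷ S) (suc i) (suc j) (s≤s i<j) = s≤s (embed-mono⁻ S i j i<j)
embed-mono⁻ (false ∷ S) i       j       (s≤s i<j) = embed-mono⁻ S i j i<j

countFin-embed : ∀ {m} (S : Vec Bool m) (p : Fin m → Bool) →
  countFin (p ∘ embed S) ≡ countFin (λ i → lookup S i ∧ p i)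
countFin-embed []          p = refl
countFin-embed (true ∷ S)  p rewrite countFin-suc (p ∘ embed (true ∷ S))
                                   | countFin-suc (λ i → lookup (true ∷ S) i ∧ p i) with p zero
... | true  = cong suc (countFin-embed S (p ∘ suc))
... | false = countFin-embed S (p ∘ suc)
countFin-embed (false ∷ S) p rewrite countFin-suc (λ i → lookup (false ∷ S) i ∧ p i) =
  countFin-embed S (p ∘ suc)

∈-mapMaybe⁺ : ∀ {X Y : Set} (f : X → Maybe Y) {x y} xs → x ∈ xs → f x ≡ just y → y ∈ mapMaybe f xs
∈-mapMaybe⁺ f (x ∷ xs) (here refl) fx rewrite fx = here refl
∈-mapMaybe⁺ f (x′ ∷ xs) (there x∈) fx with f x′
... | just _  = there (∈-mapMaybe⁺ f xs x∈ fx)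
... | nothing = ∈-mapMaybe⁺ f xs x∈ fx

∈-mapMaybe⁻ : ∀ {X Y : Set} (f : X → Maybe Y) {y} xs → y ∈ mapMaybe f xs →
  ∃ λ x → x ∈ xs × f x ≡ just y
∈-mapMaybe⁻ f (x ∷ xs) y∈ with f x in fx
∈-mapMaybe⁻ f (x ∷ xs) (here refl) | just _ = x , here refl , fx
∈-mapMaybe⁻ f (x ∷ xs) (there y∈)  | just _ with ∈-mapMaybe⁻ f xs y∈
... | x′ , x′∈ , fx′ = x′ , there x′∈ , fx′
∈-mapMaybe⁻ f (x ∷ xs) y∈ | nothing with ∈-mapMaybe⁻ f xs y∈
... | x′ , x′∈ , fx′ = x′ , there x′∈ , fx′

zipWith-just⁻ : ∀ {X Y : Set} {a : Maybe X} {b : Maybe Y} {x y} →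
  M.zipWith _,_ a b ≡ just (x , y) → a ≡ just x × b ≡ just y
zipWith-just⁻ {a = just _} {b = just _} refl = refl , refl

∈-restrict⁻ : ∀ {m} (S : Vec Bool m) (A : Edges m) {p q} → (p , q) ∈ restrict S A → (embed S p , embed S q) ∈ A
∈-restrict⁻ S A p,q∈ with ∈-mapMaybe⁻ (restrictEdge S) A p,q∈
... | (a , b) , a,b∈ , e with zipWith-just⁻ {a = reindex S a} {b = reindex S b} e
...   | ea , eb rewrite proj₁ (reindex-just⁻ S a ea) | proj₁ (reindex-just⁻ S b eb) = a,b∈

∈-restrict⁺ : ∀ {m} (S : Vec Bool m) (A : Edges m) {p q} → (embed S p , embed S q) ∈ A → (p , q) ∈ restrict S A
∈-restrict⁺ S A {p} {q} e∈ =
  ∈-mapMaybe⁺ (restrictEdge S) A e∈ (cong₂ (M.zipWith _,_) (reindex-embed S p) (reindex-embed S q))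

Uncut : ∀ {m} → Vec Bool m → Edges m → Set
Uncut S A = ∀ a b → (a , b) ∈ A → lookup S a ≡ lookup S b

Uncut-Walk : ∀ {m} (S : Vec Bool m) (A : Edges m) → Uncut S A → ∀ {x y} → Walk A x y → lookup S x ≡ lookup S y
Uncut-Walk S A uncut []                       = refl
Uncut-Walk S A uncut (_▷_ {u} {v} w (inj₁ e)) = trans (Uncut-Walk S A uncut w) (uncut u v e)
Uncut-Walk S A uncut (_▷_ {u} {v} w (inj₂ e)) = trans (Uncut-Walk S A uncut w) (sym (uncut v u e))

Walk-restrict⁻ : ∀ {m} (S : Vec Bool m) (A : Edges m) {x y} → Walk (restrict S A) x y → Walk A (embed S x) (embed S y)
Walk-restrict⁻ S A []             = []
Walk-restrict⁻ S A (w ▷ inj₁ e)  = Walk-restrict⁻ S A w ▷ inj₁ (∈-restrict⁻ S A e)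
Walk-restrict⁻ S A (w ▷ inj₂ e)  = Walk-restrict⁻ S A w ▷ inj₂ (∈-restrict⁻ S A e)

Walk-restrict⁺ : ∀ {m} (S : Vec Bool m) (A : Edges m) → Uncut S A → ∀ x′ {y} → Walk A (embed S x′) y →
  ∀ y′ → embed S y′ ≡ y → Walk (restrict S A) x′ y′
Walk-restrict⁺ S A uncut x′ [] y′ eq = subst (Walk (restrict S A) x′) (embed-injective S x′ y′ (sym eq)) []
Walk-restrict⁺ S A uncut x′ (_▷_ {u} w a) y′ refl
  with embed-onto S u (trans (Uncut-Walk S A uncut ([] ▷ a)) (embed-inside S y′))
... | u′ , refl = Walk-restrict⁺ S A uncut x′ w u′ refl ▷ lift a
  where
  lift : Adjacent A (embed S u′) (embed S y′) → Adjacent (restrict S A) u′ y′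
  lift (inj₁ e) = inj₁ (∈-restrict⁺ S A e)
  lift (inj₂ e) = inj₂ (∈-restrict⁺ S A e)

isRoot-restrict : ∀ {m} (S : Vec Bool m) (A : Edges m) → Uncut S A → ∀ i →
  isRoot (restrict S A) i ≡ isRoot A (embed S i)
isRoot-restrict S A uncut i = true⇔⇒≡ to from
  where
  to : isRoot (restrict S A) i ≡ true → isRoot A (embed S i) ≡ true
  to root = minimal⇒isRoot A (embed S i) λ j j<i w →
    lower (embed-onto S j (trans (Uncut-Walk S A uncut w) (embed-inside S i))) j<i w
    where
    lower : ∀ {j} → (∃ λ j′ → embed S j′ ≡ j) → toℕ j < toℕ (embed S i) → Walk A j (embed S i) → ⊥
    lower (j′ , refl) j<i w =
      isRoot⇒minimal _ i root j′ (embed-mono⁻ S j′ i j<i) (Walk-restrict⁺ S A uncut j′ w i refl)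
  from : isRoot A (embed S i) ≡ true → isRoot (restrict S A) i ≡ true
  from root = minimal⇒isRoot _ i λ j j<i w →
    isRoot⇒minimal A (embed S i) root (embed S j) (embed-mono S j i j<i) (Walk-restrict⁻ S A w)

#components-restrict : ∀ {m} (S : Vec Bool m) (A : Edges m) → Uncut S A →
  #components (restrict S A) ≡ countFin (λ i → lookup S i ∧ isRoot A i)
#components-restrict S A uncut =
  trans (countL-cong (allFinL (count S)) (isRoot-restrict S A uncut)) (countFin-embed S (isRoot A))

lookup-complement : ∀ {m} (S : Vec Bool m) i → lookup (complement S) i ≡ not (lookup S i)
lookup-complement (x ∷ S) zero    = refl
lookup-complement (x ∷ S) (suc i) = lookup-complement S i

Uncut-complement : ∀ {m} (S : Vec Bool m) (A : Edges m) → Uncut S A → Uncut (complement S) A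
Uncut-complement S A uncut a b e
  rewrite lookup-complement S a | lookup-complement S b | uncut a b e = refl

count-complement : ∀ {m} (S : Vec Bool m) → count S ℕ.+ count (complement S) ≡ m
count-complement []          = refl
count-complement (true  ∷ S) = cong suc (count-complement S)
count-complement (false ∷ S) = trans (ℕₚ.+-suc (count S) _) (cong suc (count-complement S))

#components-split : ∀ {m} (S : Vec Bool m) (A : Edges m) → Uncut S A →
  #components (restrict S A) ℕ.+ #components (restrict (complement S) A) ≡ #components A
#components-split {m} S A uncut = trans
  (cong₂ ℕ._+_ (#components-restrict S A uncut)
    (trans (#components-restrict (complement S) A (Uncut-complement S A uncut))
           (countL-cong (allFinL m) (λ i → cong (_∧ isRoot A i) (lookup-complement S i)))))
  (sym (countL-partition (lookup S) (isRoot A) (allFinL m)))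

restrictEdge-inside : ∀ {m} (S : Vec Bool m) a b → lookup S a ≡ true → lookup S b ≡ true →
  ∃ λ e → restrictEdge S (a , b) ≡ just e
restrictEdge-inside S a b ina inb with reindex-inside S a ina | reindex-inside S b inb
... | a′ , ea | b′ , eb rewrite ea | eb = (a′ , b′) , refl

restrictEdge-outside : ∀ {m} (S : Vec Bool m) a b → lookup S a ≡ false → restrictEdge S (a , b) ≡ nothing
restrictEdge-outside S a b outa rewrite reindex-outside S a outa = refl

length-split : ∀ {m} (S : Vec Bool m) (A : Edges m) → Uncut S A →
  length (restrict S A) ℕ.+ length (restrict (complement S) A) ≡ length A
length-split S [] uncut = refl
length-split S ((a , b) ∷ A) uncut with lookup S a in sa
... | true  with restrictEdge-inside S a b sa (trans (sym (uncut a b (here refl))) sa)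
               | restrictEdge-outside (complement S) a b (trans (lookup-complement S a) (cong not sa))
...   | _ , e₁ | e₂ rewrite e₁ | e₂ = cong suc (length-split S A (λ x y e → uncut x y (there e)))
length-split S ((a , b) ∷ A) uncut | false
  with restrictEdge-outside S a b sa
     | restrictEdge-inside (complement S) a b (trans (lookup-complement S a) (cong not sa))
         (trans (lookup-complement S b) (cong not (trans (sym (uncut a b (here refl))) sa)))
... | e₁ | _ , e₂ rewrite e₁ | e₂ =
  trans (ℕₚ.+-suc _ _) (cong suc (length-split S A (λ x y e → uncut x y (there e))))

∸-+-distrib : ∀ {l₁ l₂ r₁ r₂} → r₁ ≤ l₁ → r₂ ≤ l₂ →
  (l₁ ℕ.+ l₂) ∸ (r₁ ℕ.+ r₂) ≡ (l₁ ∸ r₁) ℕ.+ (l₂ ∸ r₂)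
∸-+-distrib {l₁} {l₂} {r₁} {r₂} r₁≤l₁ r₂≤l₂ = begin
  (l₁ ℕ.+ l₂) ∸ (r₁ ℕ.+ r₂)    ≡⟨ sym (ℕₚ.∸-+-assoc (l₁ ℕ.+ l₂) r₁ r₂) ⟩
  (l₁ ℕ.+ l₂) ∸ r₁ ∸ r₂        ≡⟨ cong (_∸ r₂) (ℕₚ.+-∸-comm l₂ r₁≤l₁) ⟩
  ((l₁ ∸ r₁) ℕ.+ l₂) ∸ r₂      ≡⟨ ℕₚ.+-∸-assoc (l₁ ∸ r₁) r₂≤l₂ ⟩
  (l₁ ∸ r₁) ℕ.+ (l₂ ∸ r₂)      ∎
  where open ≡-Reasoning

rank-split : ∀ {m} (S : Vec Bool m) (A : Edges m) → Uncut S A →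
  rank (restrict S A) ℕ.+ rank (restrict (complement S) A) ≡ rank A
rank-split S A uncut = trans
  (sym (∸-+-distrib (#components-≤ (restrict S A)) (#components-≤ (restrict (complement S) A))))
  (cong₂ _∸_ (count-complement S) (#components-split S A uncut))

nullity-split : ∀ {m} (S : Vec Bool m) (A : Edges m) → Uncut S A →
  nullity (restrict S A) ℕ.+ nullity (restrict (complement S) A) ≡ nullity A
nullity-split S A uncut = trans
  (sym (∸-+-distrib (rank-≤-length (restrict S A)) (rank-≤-length (restrict (complement S) A))))
  (cong₂ _∸_ (length-split S A uncut) (rank-split S A uncut))

∈-subLists⇒⊆ : ∀ {X : Set} (es : List X) {A} → A ∈ subLists es → ∀ {e} → e ∈ A → e ∈ es
∈-subLists⇒⊆ []       (here refl) ()
∈-subLists⇒⊆ (x ∷ es) A∈ e∈ with ∈-++⁻ (subLists es) A∈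
... | inj₁ A∈es = there (∈-subLists⇒⊆ es A∈es e∈)
... | inj₂ A∈x∷ with ∈-map⁻ (x ∷_) A∈x∷
...   | A′ , A′∈ , refl with e∈
...     | here refl = here refl
...     | there e∈′ = there (∈-subLists⇒⊆ es A′∈ e∈′)

count-replicate-false : ∀ k → count (replicate k false) ≡ 0
count-replicate-false zero    = refl
count-replicate-false (suc k) = count-replicate-false k

count-pos : ∀ {k} (S : Vec Bool k) → S ≢ replicate k false → 1 ≤ count S
count-pos []          S≢∅ = ⊥-elim (S≢∅ refl)
count-pos (true  ∷ S) S≢∅ = s≤s z≤n
count-pos (false ∷ S) S≢∅ = count-pos S (S≢∅ ∘ cong (false ∷_))

complement-replicate-false : ∀ k → complement (replicate k false) ≡ replicate k true
complement-replicate-false zero    = refl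
complement-replicate-false (suc k) = cong (true ∷_) (complement-replicate-false k)

count-replicate-true : ∀ k → count (replicate k true) ≡ k
count-replicate-true zero    = refl
count-replicate-true (suc k) = cong suc (count-replicate-true k)

reindex-replicate-true : ∀ {k} (u : Fin k) →
  reindex (replicate k true) u ≡ just (cast (sym (count-replicate-true k)) u)
reindex-replicate-true zero    = refl
reindex-replicate-true (suc u) rewrite reindex-replicate-true u = refl

mapMaybe-just∘ : ∀ {X Y : Set} (f : X → Maybe Y) (g : X → Y) → (∀ x → f x ≡ just (g x)) →
  ∀ xs → mapMaybe f xs ≡ L.map g xs
mapMaybe-just∘ f g f≗just∘g []       = refl
mapMaybe-just∘ f g f≗just∘g (x ∷ xs) rewrite f≗just∘g x = cong (g x ∷_) (mapMaybe-just∘ f g f≗just∘g xs)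

mkGraph-cast : ∀ {a b} (eq : a ≡ b) (es : Edges b) →
  mkGraph a (L.map (λ e → cast (sym eq) (proj₁ e) , cast (sym eq) (proj₂ e)) es) ≡ mkGraph b es
mkGraph-cast refl es = cong (mkGraph _) (trans
  (List.map-cong (λ e → cong₂ _,_ (Finₚ.cast-is-id refl (proj₁ e)) (Finₚ.cast-is-id refl (proj₂ e))) es)
  (List.map-id es))

induced-all : ∀ G → induced G (replicate (n G) true) ≡ G
induced-all G = trans
  (cong (mkGraph _) (mapMaybe-just∘ _ _
    (λ { (u , v) → cong₂ (M.zipWith _,_) (reindex-replicate-true u) (reindex-replicate-true v) }) (edges G)))
  (mkGraph-cast (count-replicate-true (n G)) (edges G))

induced-complement-none : ∀ G → induced G (complement (replicate (n G) false)) ≡ G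
induced-complement-none G = trans (cong (induced G) (complement-replicate-false (n G))) (induced-all G)

-- Vectors and predicates on Fin m are reindexed by ℕ (with a default
-- value out of range) so that the last vertex can be peeled off with _∷ʳ_.
lookupℕ : ∀ {X : Set} {k} → X → Vec X k → ℕ → X
lookupℕ d []      i       = d
lookupℕ d (x ∷ v) zero    = x
lookupℕ d (x ∷ v) (suc i) = lookupℕ d v i

lookupℕ-toℕ : ∀ {X : Set} {k} (d : X) (v : Vec X k) (j : Fin k) → lookupℕ d v (toℕ j) ≡ lookup v j
lookupℕ-toℕ d (x ∷ v) zero    = refl
lookupℕ-toℕ d (x ∷ v) (suc j) = lookupℕ-toℕ d v j

lookupℕ-out : ∀ {X : Set} {k} (d : X) (v : Vec X k) i → k ≤ i → lookupℕ d v i ≡ d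
lookupℕ-out d []      i       _         = refl
lookupℕ-out d (x ∷ v) (suc i) (s≤s k≤i) = lookupℕ-out d v i k≤i

lookupℕ-tabulate : ∀ {X : Set} {k} (d : X) (f : Fin k → X) (j : Fin k) → lookupℕ d (tabulate f) (toℕ j) ≡ f j
lookupℕ-tabulate d f j = trans (lookupℕ-toℕ d (tabulate f) j) (lookup∘tabulate f j)

lookupℕ-∷ʳ : ∀ {X : Set} {k} (d : X) (v : Vec X k) t i → i < k → lookupℕ d (v ∷ʳ t) i ≡ lookupℕ d v i
lookupℕ-∷ʳ d (x ∷ v) t zero    _         = refl
lookupℕ-∷ʳ d (x ∷ v) t (suc i) (s≤s i<k) = lookupℕ-∷ʳ d v t i i<k

lookupℕ-∷ʳ-last : ∀ {X : Set} {k} (d : X) (v : Vec X k) t → lookupℕ d (v ∷ʳ t) k ≡ t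
lookupℕ-∷ʳ-last d []      t = refl
lookupℕ-∷ʳ-last d (x ∷ v) t = lookupℕ-∷ʳ-last d v t

below-or-toℕ : ∀ k i → k ≤ i ⊎ ∃ λ (j : Fin k) → toℕ j ≡ i
below-or-toℕ zero    i       = inj₁ z≤n
below-or-toℕ (suc k) zero    = inj₂ (zero , refl)
below-or-toℕ (suc k) (suc i) with below-or-toℕ k i
... | inj₁ k≤i     = inj₁ (s≤s k≤i)
... | inj₂ (j , e) = inj₂ (suc j , cong suc e)

allℕ : ℕ → (ℕ → Bool) → Bool
allℕ zero    p = true
allℕ (suc k) p = allℕ k p ∧ p k

allℕ-true⁺ : ∀ k p → (∀ i → i < k → p i ≡ true) → allℕ k p ≡ true
allℕ-true⁺ zero    p all = refl
allℕ-true⁺ (suc k) p all rewrite allℕ-true⁺ k p (λ i i<k → all i (ℕₚ.m<n⇒m<1+n i<k)) = all k ℕₚ.≤-refl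

allℕ-true⁻ : ∀ k p → allℕ k p ≡ true → ∀ i → i < k → p i ≡ true
allℕ-true⁻ (suc k) p all i i<1+k with ∧-true⁻ (allℕ k p) all | ℕₚ.m<1+n⇒m<n∨m≡n i<1+k
... | below , _    | inj₁ i<k  = allℕ-true⁻ k p below i i<k
... | _     , last | inj₂ refl = last

countℕ : ℕ → (ℕ → Bool) → ℕ
countℕ zero    p = 0
countℕ (suc k) p = countℕ k p ℕ.+ (if p k then 1 else 0)

countℕ-suc-head : ∀ k p → countℕ (suc k) p ≡ (if p 0 then 1 else 0) ℕ.+ countℕ k (p ∘ suc)
countℕ-suc-head zero    p = ℕₚ.+-comm 0 _
countℕ-suc-head (suc k) p = trans (cong (ℕ._+ (if p (suc k) then 1 else 0)) (countℕ-suc-head k p))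
  (ℕₚ.+-assoc (if p 0 then 1 else 0) _ _)

countℕ≡countFin : ∀ k p → countℕ k p ≡ countFin {k} (p ∘ toℕ)
countℕ≡countFin zero    p = refl
countℕ≡countFin (suc k) p rewrite countℕ-suc-head k p | countFin-suc {k} (p ∘ toℕ)
                                | countℕ≡countFin k (p ∘ suc) with p 0
... | true  = refl
... | false = refl

findᵇ-just : ∀ {X : Set} (p : X → Bool) xs → anyL p xs ≡ true →
  ∃ λ x → L.findᵇ p xs ≡ just x × p x ≡ true
findᵇ-just p (x ∷ xs) any with p x in px
... | true  = x , refl , px
... | false = findᵇ-just p xs any

module Parents (m : ℕ) (A : Edges m) where

  parent : Fin m → Fin m
  parent i = M.fromMaybe i (L.findᵇ (λ j → (toℕ j ℕ.<ᵇ toℕ i) ∧ connected (mkGraph m A) j i) (allFinL m))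

  parent-below : ∀ i → isRoot A i ≡ false → toℕ (parent i) < toℕ i × Walk A (parent i) i
  parent-below i ¬root
    with findᵇ-just (λ j → (toℕ j ℕ.<ᵇ toℕ i) ∧ connected (mkGraph m A) j i) (allFinL m) (not-false⁻ ¬root)
  ... | j , found , pj with ∧-true⁻ (toℕ j ℕ.<ᵇ toℕ i) pj
  ...   | j<i , ji = subst (λ z → toℕ z < toℕ i × Walk A z i) (sym (cong (M.fromMaybe i) found))
                        (<ᵇ⇒< j<i , Reachability.connected⇒Walk m A j i ji)

  isRootℕ : ℕ → Bool
  isRootℕ = lookupℕ true (tabulate (isRoot A))

  parentℕ : ℕ → ℕ
  parentℕ = lookupℕ 0 (tabulate (toℕ ∘ parent))

  isRootℕ-toℕ : ∀ j → isRootℕ (toℕ j) ≡ isRoot A j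
  isRootℕ-toℕ = lookupℕ-tabulate true (isRoot A)

  parentℕ-toℕ : ∀ j → parentℕ (toℕ j) ≡ toℕ (parent j)
  parentℕ-toℕ = lookupℕ-tabulate 0 (toℕ ∘ parent)

  parentℕ-below : ∀ i → isRootℕ i ≡ false → parentℕ i < i
  parentℕ-below i ¬root with below-or-toℕ m i
  ... | inj₁ m≤i      = ⊥-elim (true≢false (lookupℕ-out true (tabulate (isRoot A)) i m≤i) ¬root)
  ... | inj₂ (j , refl) = subst (_< toℕ j) (sym (parentℕ-toℕ j))
                            (proj₁ (parent-below j (trans (sym (isRootℕ-toℕ j)) ¬root)))

  Consistent : Vec Bool m → Bool
  Consistent S = allℕ m (λ i → isRootℕ i ∨ (lookupℕ false S i == lookupℕ false S (parentℕ i)))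

  Uncut⇒Consistent : ∀ S → Uncut S A → Consistent S ≡ true
  Uncut⇒Consistent S uncut = allℕ-true⁺ m _ consistent-at
    where
    consistent-at : ∀ i → i < m → (isRootℕ i ∨ (lookupℕ false S i == lookupℕ false S (parentℕ i))) ≡ true
    consistent-at i i<m with below-or-toℕ m i
    ... | inj₁ m≤i = ⊥-elim (ℕₚ.<-irrefl refl (ℕₚ.<-≤-trans i<m m≤i))
    ... | inj₂ (j , refl) rewrite isRootℕ-toℕ j | parentℕ-toℕ j
                                | lookupℕ-toℕ false S j | lookupℕ-toℕ false S (parent j)
                                with isRoot A j in root
    ...   | true  = refl
    ...   | false = ≡⇒== _ _ (sym (Uncut-Walk S A uncut (proj₂ (parent-below j root))))

  module _ (S : Vec Bool m) (consistent : Consistent S ≡ true) where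

    private
      consistent-at : ∀ j → isRoot A j ≡ true ⊎ lookup S j ≡ lookup S (parent j)
      consistent-at j with ∨-true⁻ _ (allℕ-true⁻ m _ consistent (toℕ j) (toℕ<n j))
      ... | inj₁ root = inj₁ (trans (sym (isRootℕ-toℕ j)) root)
      ... | inj₂ same = inj₂ (trans (sym (lookupℕ-toℕ false S j)) (trans (==⇒≡ _ _ same)
                          (trans (cong (lookupℕ false S) (parentℕ-toℕ j)) (lookupℕ-toℕ false S (parent j)))))

      ancestor : ∀ k j → toℕ j < k → ∃ λ r → isRoot A r ≡ true × Walk A r j × lookup S r ≡ lookup S j
      ancestor (suc k) j j<k with isRoot A j in root
      ... | true  = j , root , [] , refl
      ... | false with consistent-at j
      ...   | inj₁ root′ = ⊥-elim (true≢false root′ root)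
      ...   | inj₂ same with parent-below j root
      ...     | p<j , pj with ancestor k (parent j) (ℕₚ.<-≤-trans p<j (ℕ.s≤s⁻¹ j<k))
      ...       | r , rootᵣ , rp , sameᵣ = r , rootᵣ , rp ++ʷ pj , trans sameᵣ (sym same)

    Consistent⇒Uncut : Uncut S A
    Consistent⇒Uncut a b ab with ancestor (suc (toℕ a)) a ℕₚ.≤-refl | ancestor (suc (toℕ b)) b ℕₚ.≤-refl
    ... | ra , rootₐ , wa , sameₐ | rb , rootᵇ , wb , sameᵇ =
      trans (sym sameₐ) (trans (cong (lookup S) ra≡rb) sameᵇ)
      where
      ra≡rb : ra ≡ rb
      ra≡rb = connected-roots-≡ A ra rb rootₐ rootᵇ (wa ++ʷ edgeʷ ab ++ʷ reverseʷ wb)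

-- Finite sums, products and powers in a commutative ring

module RingFacts {a ℓ : Level} (R : CommutativeRing a ℓ) where

  open CommutativeRing R
    renaming (Carrier to K; refl to ≈-refl; sym to ≈-sym; trans to ≈-trans) hiding (zero)
  open import Relation.Binary.Reasoning.Setoid setoid
  open import Algebra.Properties.Ring ring public using (-1*x≈-x; -‿involutive)
  open import Algebra.Properties.CommutativeSemigroup +-commutativeSemigroup
    using () renaming (interchange to +-interchange)
  open import Algebra.Properties.CommutativeSemigroup *-commutativeSemigroup public
    using () renaming (interchange to *-interchange; xy∙z≈xz∙y to *-swapʳ)
  open import Algebra.Properties.CommutativeSemiring.Exp commutativeSemiring
    using (_^_; ^-congˡ; ^-homo-*; ^-distrib-*)
  open import Algebra.Properties.AbelianGroup +-abelianGroup using (⁻¹-∙-comm)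
  open import Algebra.Properties.Group +-group using () renaming (ε⁻¹≈ε to -0#≈0#)

  ∑ : {X : Set} → List X → (X → K) → K
  ∑ xs f = sumL R (L.map f xs)

  syntax ∑ xs (λ x → e) = ∑[ x ← xs ] e

  module _ {X : Set} where

    ∑-cong : ∀ xs {f g : X → K} → (∀ x → f x ≈ g x) → ∑ xs f ≈ ∑ xs g
    ∑-cong []       f≈g = ≈-refl
    ∑-cong (x ∷ xs) f≈g = +-cong (f≈g x) (∑-cong xs f≈g)

    ∑-cong-∈ : ∀ xs {f g : X → K} → (∀ x → x ∈ xs → f x ≈ g x) → ∑ xs f ≈ ∑ xs g
    ∑-cong-∈ []       f≈g = ≈-refl
    ∑-cong-∈ (x ∷ xs) f≈g = +-cong (f≈g x (here refl)) (∑-cong-∈ xs (λ z z∈ → f≈g z (there z∈)))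

    ∑-++ : ∀ xs ys (f : X → K) → ∑ (xs ++ ys) f ≈ ∑ xs f + ∑ ys f
    ∑-++ []       ys f = ≈-sym (+-identityˡ _)
    ∑-++ (x ∷ xs) ys f = ≈-trans (+-congˡ (∑-++ xs ys f)) (≈-sym (+-assoc (f x) _ _))

    ∑-+ : ∀ xs (f g : X → K) → ∑[ x ← xs ] (f x + g x) ≈ ∑ xs f + ∑ xs g
    ∑-+ []       f g = ≈-sym (+-identityˡ _)
    ∑-+ (x ∷ xs) f g = ≈-trans (+-congˡ (∑-+ xs f g)) (+-interchange (f x) (g x) _ _)

    ∑-*ʳ : ∀ xs (f : X → K) c → ∑[ x ← xs ] (f x * c) ≈ ∑ xs f * c
    ∑-*ʳ []       f c = ≈-sym (zeroˡ c)
    ∑-*ʳ (x ∷ xs) f c = ≈-trans (+-congˡ (∑-*ʳ xs f c)) (≈-sym (distribʳ c (f x) _))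

    ∑-*ˡ : ∀ xs (f : X → K) c → ∑[ x ← xs ] (c * f x) ≈ c * ∑ xs f
    ∑-*ˡ []       f c = ≈-sym (zeroʳ c)
    ∑-*ˡ (x ∷ xs) f c = ≈-trans (+-congˡ (∑-*ˡ xs f c)) (≈-sym (distribˡ c (f x) _))

    ∑-zero : ∀ xs (f : X → K) → (∀ x → f x ≈ 0#) → ∑ xs f ≈ 0#
    ∑-zero []       f f≈0 = ≈-refl
    ∑-zero (x ∷ xs) f f≈0 = ≈-trans (+-cong (f≈0 x) (∑-zero xs f f≈0)) (+-identityˡ 0#)

  ∑-map : ∀ {X Y : Set} (g : X → Y) xs (f : Y → K) → ∑ (L.map g xs) f ≡ ∑ xs (f ∘ g)
  ∑-map g []       f = refl
  ∑-map g (x ∷ xs) f = cong (f (g x) +_) (∑-map g xs f)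

  ∑-comm : ∀ {X Y : Set} xs ys (h : X → Y → K) →
    ∑[ x ← xs ] ∑[ y ← ys ] h x y ≈ ∑[ y ← ys ] ∑[ x ← xs ] h x y
  ∑-comm []       ys h = ≈-sym (∑-zero ys (λ _ → 0#) (λ _ → ≈-refl))
  ∑-comm (x ∷ xs) ys h =
    ≈-trans (+-congˡ (∑-comm xs ys h)) (≈-sym (∑-+ ys (h x) (λ y → ∑[ x ← xs ] h x y)))

  ∑-*-∑ : ∀ {X Y : Set} xs ys (f : X → K) (g : Y → K) →
    ∑ xs f * ∑ ys g ≈ ∑[ x ← xs ] ∑[ y ← ys ] (f x * g y)
  ∑-*-∑ xs ys f g = ≈-trans (≈-sym (∑-*ʳ xs f _)) (∑-cong xs (λ x → ≈-sym (∑-*ˡ ys g (f x))))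

  ∑-subLists-∷ : ∀ {X : Set} (x : X) xs (F : List X → K) →
    ∑ (subLists (x ∷ xs)) F ≈ ∑ (subLists xs) F + ∑[ A ← subLists xs ] F (x ∷ A)
  ∑-subLists-∷ x xs F = ≈-trans (∑-++ (subLists xs) (L.map (x ∷_) (subLists xs)) F)
    (+-congˡ (reflexive (∑-map (x ∷_) (subLists xs) F)))

  ∑ˢ : (k : ℕ) → (Vec Bool k → K) → K
  ∑ˢ k F = ∑ (allSubsets k) F

  ∑ˢ-∷ : ∀ k (F : Vec Bool (suc k) → K) →
    ∑ˢ (suc k) F ≈ ∑ˢ k (F ∘ (true ∷_)) + ∑ˢ k (F ∘ (false ∷_))
  ∑ˢ-∷ k F = ≈-trans (∑-++ (L.map (true ∷_) (allSubsets k)) (L.map (false ∷_) (allSubsets k)) F)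
    (+-cong (reflexive (∑-map (true ∷_) (allSubsets k) F)) (reflexive (∑-map (false ∷_) (allSubsets k) F)))

  ∑ˢ-∷ʳ : ∀ k (F : Vec Bool (suc k) → K) →
    ∑ˢ (suc k) F ≈ ∑ˢ k (λ S → F (S ∷ʳ true) + F (S ∷ʳ false))
  ∑ˢ-∷ʳ zero    F = ≈-trans (∑ˢ-∷ zero F)
                      (≈-trans (+-cong (+-identityʳ _) (+-identityʳ _)) (≈-sym (+-identityʳ _)))
  ∑ˢ-∷ʳ (suc k) F = begin
    ∑ˢ (suc (suc k)) F                                                   ≈⟨ ∑ˢ-∷ (suc k) F ⟩
    ∑ˢ (suc k) (F ∘ (true ∷_)) + ∑ˢ (suc k) (F ∘ (false ∷_))
      ≈⟨ +-cong (∑ˢ-∷ʳ k (F ∘ (true ∷_))) (∑ˢ-∷ʳ k (F ∘ (false ∷_))) ⟩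
    ∑ˢ k (λ S → F (true ∷ (S ∷ʳ true)) + F (true ∷ (S ∷ʳ false)))
      + ∑ˢ k (λ S → F (false ∷ (S ∷ʳ true)) + F (false ∷ (S ∷ʳ false)))
      ≈⟨ ≈-sym (∑ˢ-∷ k (λ S → F (S ∷ʳ true) + F (S ∷ʳ false))) ⟩
    ∑ˢ (suc k) (λ S → F (S ∷ʳ true) + F (S ∷ʳ false))                   ∎

  ∏ : ℕ → (ℕ → K) → K
  ∏ zero    f = 1#
  ∏ (suc k) f = ∏ k f * f k

  ∏-cong : ∀ k {f g : ℕ → K} → (∀ i → i < k → f i ≈ g i) → ∏ k f ≈ ∏ k g
  ∏-cong zero    f≈g = ≈-refl
  ∏-cong (suc k) f≈g = *-cong (∏-cong k (λ i i<k → f≈g i (ℕₚ.m<n⇒m<1+n i<k))) (f≈g k ℕₚ.≤-refl)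

  pow≡^ : ∀ x k → pow R x k ≡ x ^ k
  pow≡^ x zero    = refl
  pow≡^ x (suc k) = cong (x *_) (pow≡^ x k)

  pow-congˡ : ∀ {x y} k → x ≈ y → pow R x k ≈ pow R y k
  pow-congˡ {x} {y} k x≈y rewrite pow≡^ x k | pow≡^ y k = ^-congˡ k x≈y

  pow-congʳ : ∀ x {i j} → i ≡ j → pow R x i ≈ pow R x j
  pow-congʳ x refl = ≈-refl

  pow-+ : ∀ x i j → pow R x (i ℕ.+ j) ≈ pow R x i * pow R x j
  pow-+ x i j rewrite pow≡^ x (i ℕ.+ j) | pow≡^ x i | pow≡^ x j = ^-homo-* x i j

  pow-* : ∀ x y k → pow R (x * y) k ≈ pow R x k * pow R y k
  pow-* x y k rewrite pow≡^ (x * y) k | pow≡^ x k | pow≡^ y k = ^-distrib-* x y k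

  pow-+1 : ∀ x i → pow R x (i ℕ.+ 1) ≈ pow R x i * x
  pow-+1 x i = ≈-trans (pow-+ x i 1) (*-congˡ (*-identityʳ x))

  pow-+0 : ∀ x i → pow R x (i ℕ.+ 0) ≈ pow R x i
  pow-+0 x i = pow-congʳ x (ℕₚ.+-identityʳ i)

  pow-1# : ∀ k → pow R 1# k ≈ 1#
  pow-1# zero    = ≈-refl
  pow-1# (suc k) = ≈-trans (*-identityˡ _) (pow-1# k)

  pow-0#-suc : ∀ k → pow R 0# (suc k) ≈ 0#
  pow-0#-suc k = zeroˡ _

  pow-[-1]-square : ∀ k → pow R (- 1#) k * pow R (- 1#) k ≈ 1#
  pow-[-1]-square k = begin
    pow R (- 1#) k * pow R (- 1#) k  ≈⟨ ≈-sym (pow-* (- 1#) (- 1#) k) ⟩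
    pow R (- 1# * - 1#) k            ≈⟨ pow-congˡ k (-1*x≈-x (- 1#)) ⟩
    pow R (- - 1#) k                 ≈⟨ pow-congˡ k (-‿involutive 1#) ⟩
    pow R 1# k                       ≈⟨ pow-1# k ⟩
    1#                               ∎

  fromℕ-+1 : ∀ j → fromℕ R (j ℕ.+ 1) ≈ fromℕ R j + 1#
  fromℕ-+1 zero    = +-comm 1# 0#
  fromℕ-+1 (suc j) = ≈-trans (+-congˡ (fromℕ-+1 j)) (≈-sym (+-assoc 1# (fromℕ R j) 1#))

  -z≈-[1+z]+1 : ∀ z → - z ≈ - (1# + z) + 1#
  -z≈-[1+z]+1 z = ≈-sym (begin
    - (1# + z) + 1#      ≈⟨ +-congʳ (≈-sym (⁻¹-∙-comm 1# z)) ⟩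
    (- 1# + - z) + 1#    ≈⟨ +-congʳ (+-comm (- 1#) (- z)) ⟩
    (- z + - 1#) + 1#    ≈⟨ +-assoc (- z) (- 1#) 1# ⟩
    - z + (- 1# + 1#)    ≈⟨ +-congˡ (-‿inverseˡ 1#) ⟩
    - z + 0#             ≈⟨ +-identityʳ (- z) ⟩
    - z                  ∎)

  private
    0≈-[1+0]+1 : 0# ≈ - (1# + 0#) + 1#
    0≈-[1+0]+1 = ≈-trans (≈-sym -0#≈0#) (-z≈-[1+z]+1 0#)

  fromℤ-+1 : ∀ k → fromℤ R (k ℤ.+ 1ℤ) ≈ fromℤ R k + 1#
  fromℤ-+1 (ℤ.+ j)           = fromℕ-+1 j
  fromℤ-+1 ℤ.-[1+ zero ]     = 0≈-[1+0]+1
  fromℤ-+1 ℤ.-[1+ suc j ]    = -z≈-[1+z]+1 (1# + fromℕ R j)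

  fromℤ-1- : ∀ k → fromℤ R (1ℤ ℤ.- k) ≈ - fromℤ R k + 1#
  fromℤ-1- (ℤ.+ zero)          = ≈-trans (+-comm 1# 0#) (+-congʳ (≈-sym -0#≈0#))
  fromℤ-1- (ℤ.+ suc zero)      = 0≈-[1+0]+1
  fromℤ-1- (ℤ.+ suc (suc j))   = -z≈-[1+z]+1 (1# + fromℕ R j)
  fromℤ-1- ℤ.-[1+ j ]          =
    ≈-trans (+-comm 1# (1# + fromℕ R j)) (+-congʳ (≈-sym (-‿involutive (1# + fromℕ R j))))

  x*-1≈-x : ∀ x → x * - 1# ≈ - x
  x*-1≈-x x = ≈-trans (*-comm x (- 1#)) (-1*x≈-x x)

-- Colourings S of {0, …, k-1} by x (inside S) and y (outside S), where every
-- non-root i must share the colour of parent i < i.  Summing over the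
-- colour of the last vertex shows that the roots contribute x + y each.
module ColouringSum {a ℓ : Level} (R : CommutativeRing a ℓ) (x y : CommutativeRing.Carrier R)
  (root : ℕ → Bool) (parentℕ : ℕ → ℕ) (parent-below : ∀ i → root i ≡ false → parentℕ i < i) where

  open CommutativeRing R
    renaming (Carrier to K; refl to ≈-refl; sym to ≈-sym; trans to ≈-trans) hiding (zero)
  open import Relation.Binary.Reasoning.Setoid setoid
  open RingFacts R

  colour : ∀ {k} → Vec Bool k → ℕ → Bool
  colour S = lookupℕ false S

  Agrees : ∀ {k} → Vec Bool k → ℕ → Bool
  Agrees S i = root i ∨ (colour S i == colour S (parentℕ i))

  weight : ∀ {k} → Vec Bool k → ℕ → K
  weight S i = if root i then (if colour S i then x else y)
               else (if colour S i == colour S (parentℕ i) then 1# else 0#)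

  weight-∷ʳ : ∀ {k} (S : Vec Bool k) t i → i < k → weight (S ∷ʳ t) i ≡ weight S i
  weight-∷ʳ S t i i<k with root i in rᵢ
  ... | true  = cong (λ b → if b then x else y) (lookupℕ-∷ʳ false S t i i<k)
  ... | false = cong (λ b → if b then 1# else 0#)
                  (cong₂ _==_ (lookupℕ-∷ʳ false S t i i<k)
                              (lookupℕ-∷ʳ false S t (parentℕ i) (ℕₚ.<-trans (parent-below i rᵢ) i<k)))

  weight-last : ∀ {k} (S : Vec Bool k) →
    weight (S ∷ʳ true) k + weight (S ∷ʳ false) k ≈ (if root k then x + y else 1#)
  weight-last {k} S with root k in rₖ
  ... | true rewrite lookupℕ-∷ʳ-last false S true | lookupℕ-∷ʳ-last false S false = ≈-refl
  ... | false rewrite lookupℕ-∷ʳ-last false S true | lookupℕ-∷ʳ-last false S false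
                    | lookupℕ-∷ʳ false S true (parentℕ k) (parent-below k rₖ)
                    | lookupℕ-∷ʳ false S false (parentℕ k) (parent-below k rₖ)
                    with colour S (parentℕ k)
  ...   | true  = +-identityʳ 1#
  ...   | false = +-identityˡ 1#

  ∑-∏-weight : ∀ k → ∑ˢ k (λ S → ∏ k (weight S)) ≈ pow R (x + y) (countℕ k root)
  ∑-∏-weight zero    = +-identityʳ 1#
  ∑-∏-weight (suc k) = begin
    ∑ˢ (suc k) (λ S → ∏ (suc k) (weight S))                            ≈⟨ ∑ˢ-∷ʳ k _ ⟩
    ∑ˢ k (λ S → ∏ k (weight (S ∷ʳ true)) * weight (S ∷ʳ true) k
              + ∏ k (weight (S ∷ʳ false)) * weight (S ∷ʳ false) k)
      ≈⟨ ∑-cong (allSubsets k) (λ S → +-cong (*-congʳ (∏-weight-∷ʳ S true))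
                                             (*-congʳ (∏-weight-∷ʳ S false))) ⟩
    ∑ˢ k (λ S → ∏ k (weight S) * weight (S ∷ʳ true) k + ∏ k (weight S) * weight (S ∷ʳ false) k)
      ≈⟨ ∑-cong (allSubsets k) (λ S → ≈-trans (≈-sym (distribˡ _ _ _)) (*-congˡ (weight-last S))) ⟩
    ∑ˢ k (λ S → ∏ k (weight S) * last)                                 ≈⟨ ∑-*ʳ (allSubsets k) _ last ⟩
    ∑ˢ k (λ S → ∏ k (weight S)) * last                                 ≈⟨ *-congʳ (∑-∏-weight k) ⟩
    pow R (x + y) (countℕ k root) * last                               ≈⟨ absorb-last ⟩
    pow R (x + y) (countℕ (suc k) root)                                ∎
    where
    last : K
    last = if root k then x + y else 1#
    ∏-weight-∷ʳ : ∀ S t → ∏ k (weight (S ∷ʳ t)) ≈ ∏ k (weight S)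
    ∏-weight-∷ʳ S t = ∏-cong k (λ i i<k → reflexive (weight-∷ʳ S t i i<k))
    absorb-last : pow R (x + y) (countℕ k root) * last ≈ pow R (x + y) (countℕ (suc k) root)
    absorb-last with root k
    ... | true  = ≈-sym (pow-+1 (x + y) (countℕ k root))
    ... | false = ≈-trans (*-identityʳ _) (≈-sym (pow-+0 (x + y) (countℕ k root)))

  #rootsIn #rootsOut : ∀ {m} → Vec Bool m → ℕ → ℕ
  #rootsIn  S k = countℕ k (λ i → root i ∧ colour S i)
  #rootsOut S k = countℕ k (λ i → root i ∧ not (colour S i))

  ∏-weight : ∀ {m} (S : Vec Bool m) k → ∏ k (weight S) ≈
    (if allℕ k (Agrees S) then pow R x (#rootsIn S k) * pow R y (#rootsOut S k) else 0#)
  ∏-weight S zero = ≈-sym (*-identityˡ 1#)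
  ∏-weight S (suc k) with allℕ k (Agrees S) | ∏-weight S k
  ... | false | ih = ≈-trans (*-congʳ ih) (zeroˡ _)
  ... | true  | ih with root k | colour S k
  ...   | true  | true  = ≈-trans (*-congʳ ih) (≈-trans (*-swapʳ _ _ x)
                            (*-cong (≈-sym (pow-+1 x (#rootsIn S k))) (≈-sym (pow-+0 y (#rootsOut S k)))))
  ...   | true  | false = ≈-trans (*-congʳ ih) (≈-trans (*-assoc _ _ y)
                            (*-cong (≈-sym (pow-+0 x (#rootsIn S k))) (≈-sym (pow-+1 y (#rootsOut S k)))))
  ...   | false | s with s == colour S (parentℕ k)
  ...     | true  = ≈-trans (*-congʳ ih) (≈-trans (*-identityʳ _)
                      (*-cong (≈-sym (pow-+0 x (#rootsIn S k))) (≈-sym (pow-+0 y (#rootsOut S k)))))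
  ...     | false = zeroʳ _

allL : ∀ {X : Set} → (X → Bool) → List X → Bool
allL p = L.foldr (λ x b → p x ∧ b) true

all-true⁻ : ∀ {X : Set} (p : X → Bool) xs → allL p xs ≡ true → ∀ x → x ∈ xs → p x ≡ true
all-true⁻ p (y ∷ xs) all x (here refl) = proj₁ (∧-true⁻ (p y) all)
all-true⁻ p (y ∷ xs) all x (there x∈)  = all-true⁻ p xs (proj₂ (∧-true⁻ (p y) all)) x x∈

all-true⁺ : ∀ {X : Set} (p : X → Bool) xs → (∀ x → x ∈ xs → p x ≡ true) → allL p xs ≡ true
all-true⁺ p []       all = refl
all-true⁺ p (y ∷ xs) all = cong₂ _∧_ (all y (here refl)) (all-true⁺ p xs (λ x x∈ → all x (there x∈)))

is-just-reindex : ∀ {m} (S : Vec Bool m) u → is-just (reindex S u) ≡ lookup S u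
is-just-reindex S u with lookup S u in su
... | true  with reindex-inside S u su
...   | _ , eq rewrite eq = refl
is-just-reindex S u | false rewrite reindex-outside S u su = refl

is-just-restrictEdge : ∀ {m} (S : Vec Bool m) a b → is-just (restrictEdge S (a , b)) ≡ lookup S a ∧ lookup S b
is-just-restrictEdge S a b = trans (is-just-zip (reindex S a) (reindex S b))
                                   (cong₂ _∧_ (is-just-reindex S a) (is-just-reindex S b))
  where
  is-just-zip : ∀ {X Y : Set} (p : Maybe X) (q : Maybe Y) → is-just (M.zipWith _,_ p q) ≡ is-just p ∧ is-just q
  is-just-zip (just _) (just _) = refl
  is-just-zip (just _) nothing  = refl
  is-just-zip nothing  _        = refl

keptEdge : ∀ {m} (S : Vec Bool m) → Fin m × Fin m → Bool
keptEdge S e = is-just (restrictEdge S e) ∨ is-just (restrictEdge (complement S) e)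

keptEdge-== : ∀ {m} (S : Vec Bool m) a b → keptEdge S (a , b) ≡ (lookup S a == lookup S b)
keptEdge-== S a b rewrite is-just-restrictEdge S a b | is-just-restrictEdge (complement S) a b
                        | lookup-complement S a | lookup-complement S b
                        with lookup S a | lookup S b
... | true  | true  = refl
... | true  | false = refl
... | false | true  = refl
... | false | false = refl

restrictEdge-disjoint : ∀ {m} (S : Vec Bool m) e →
  is-just (restrictEdge S e) ∧ is-just (restrictEdge (complement S) e) ≡ false
restrictEdge-disjoint S (a , b) rewrite is-just-restrictEdge S a b | is-just-restrictEdge (complement S) a b
                                      | lookup-complement S a | lookup-complement S b
                                      with lookup S a | lookup S b
... | true  | true  = refl
... | true  | false = refl
... | false | true  = refl
... | false | false = refl

all-keptEdge⇒Uncut : ∀ {m} (S : Vec Bool m) A → allL (keptEdge S) A ≡ true → Uncut S A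
all-keptEdge⇒Uncut S A all a b e = ==⇒≡ _ _ (trans (sym (keptEdge-== S a b)) (all-true⁻ (keptEdge S) A all (a , b) e))

Uncut⇒all-keptEdge : ∀ {m} (S : Vec Bool m) A → Uncut S A → allL (keptEdge S) A ≡ true
Uncut⇒all-keptEdge S A uncut =
  all-true⁺ (keptEdge S) A (λ { (a , b) e → trans (keptEdge-== S a b) (≡⇒== _ _ (uncut a b e)) })

-- Pairs of sublists of the two images of xs under partial maps with disjoint
-- domains are the images of the sublists of xs inside the union of the domains.
module SubListPairs {a ℓ : Level} (R : CommutativeRing a ℓ) {X Y Z : Set}
  (f : X → Maybe Y) (h : X → Maybe Z) (disjoint : ∀ x → is-just (f x) ∧ is-just (h x) ≡ false) where

  open CommutativeRing R
    renaming (Carrier to K; refl to ≈-refl; sym to ≈-sym; trans to ≈-trans) hiding (zero)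
  open import Relation.Binary.Reasoning.Setoid setoid
  open RingFacts R

  covered : X → Bool
  covered x = is-just (f x) ∨ is-just (h x)

  ∑-pairs : (List Y → List Z → K) → List Y → List Z → K
  ∑-pairs F ys zs = ∑[ A₁ ← subLists ys ] ∑[ A₂ ← subLists zs ] F A₁ A₂

  ∑-covered : (List Y → List Z → K) → List X → K
  ∑-covered F xs = ∑[ A ← subLists xs ] (if allL covered A then F (mapMaybe f A) (mapMaybe h A) else 0#)

  private
    cons? : ∀ {W : Set} → Maybe W → List W → List W
    cons? = M.maybe′ _∷_ id

    with-x : (List Y → List Z → K) → List X → Maybe Y → Maybe Z → Bool → K
    with-x F A fx hx all = if (is-just fx ∨ is-just hx) ∧ all
                           then F (cons? fx (mapMaybe f A)) (cons? hx (mapMaybe h A)) else 0#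

    with-x-cong : ∀ F x xs {p q} → p ≡ f x → q ≡ h x →
      ∑[ A ← subLists xs ] with-x F A p q (allL covered A)
        ≈ ∑[ A ← subLists xs ] with-x F A (f x) (h x) (allL covered A)
    with-x-cong F x xs refl refl = ≈-refl

  ∑-pairs≈∑-covered : ∀ F xs → ∑-pairs F (mapMaybe f xs) (mapMaybe h xs) ≈ ∑-covered F xs
  ∑-pairs≈∑-covered F [] = ≈-trans (+-identityʳ _) (≈-trans (+-identityʳ _) (≈-sym (+-identityʳ _)))
  ∑-pairs≈∑-covered F (x ∷ xs) with f x in fx | h x in hx
  ... | just _  | just _  = ⊥-elim (true≢false refl
         (subst (_≡ false) (cong₂ (λ p q → is-just p ∧ is-just q) fx hx) (disjoint x)))
  ... | just y  | nothing = begin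
    ∑-pairs F (y ∷ mapMaybe f xs) (mapMaybe h xs)                ≈⟨ ∑-subLists-∷ y (mapMaybe f xs) _ ⟩
    ∑-pairs F (mapMaybe f xs) (mapMaybe h xs) + ∑-pairs (λ A₁ → F (y ∷ A₁)) (mapMaybe f xs) (mapMaybe h xs)
      ≈⟨ +-cong (∑-pairs≈∑-covered F xs) (∑-pairs≈∑-covered (λ A₁ → F (y ∷ A₁)) xs) ⟩
    ∑-covered F xs + ∑-covered (λ A₁ → F (y ∷ A₁)) xs
      ≈⟨ +-congˡ (with-x-cong F x xs (sym fx) (sym hx)) ⟩
    ∑-covered F xs + ∑[ A ← subLists xs ] with-x F A (f x) (h x) (allL covered A)
      ≈⟨ ≈-sym (∑-subLists-∷ x xs _) ⟩
    ∑-covered F (x ∷ xs)                                         ∎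
  ... | nothing | just z  = begin
    ∑-pairs F (mapMaybe f xs) (z ∷ mapMaybe h xs)
      ≈⟨ ∑-cong (subLists (mapMaybe f xs)) (λ A₁ → ∑-subLists-∷ z (mapMaybe h xs) _) ⟩
    ∑[ A₁ ← subLists (mapMaybe f xs) ] (∑[ A₂ ← subLists (mapMaybe h xs) ] F A₁ A₂
                                        + ∑[ A₂ ← subLists (mapMaybe h xs) ] F A₁ (z ∷ A₂))
      ≈⟨ ∑-+ (subLists (mapMaybe f xs)) _ _ ⟩
    ∑-pairs F (mapMaybe f xs) (mapMaybe h xs)
      + ∑-pairs (λ A₁ A₂ → F A₁ (z ∷ A₂)) (mapMaybe f xs) (mapMaybe h xs)
      ≈⟨ +-cong (∑-pairs≈∑-covered F xs) (∑-pairs≈∑-covered (λ A₁ A₂ → F A₁ (z ∷ A₂)) xs) ⟩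
    ∑-covered F xs + ∑-covered (λ A₁ A₂ → F A₁ (z ∷ A₂)) xs
      ≈⟨ +-congˡ (with-x-cong F x xs (sym fx) (sym hx)) ⟩
    ∑-covered F xs + ∑[ A ← subLists xs ] with-x F A (f x) (h x) (allL covered A)
      ≈⟨ ≈-sym (∑-subLists-∷ x xs _) ⟩
    ∑-covered F (x ∷ xs)                                         ∎
  ... | nothing | nothing = begin
    ∑-pairs F (mapMaybe f xs) (mapMaybe h xs)                    ≈⟨ ∑-pairs≈∑-covered F xs ⟩
    ∑-covered F xs                                               ≈⟨ ≈-sym (+-identityʳ _) ⟩
    ∑-covered F xs + 0#
      ≈⟨ +-congˡ (≈-sym (∑-zero (subLists xs) _ (λ A → reflexive
           (cong₂ (λ p q → with-x F A p q (allL covered A)) fx hx)))) ⟩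
    ∑-covered F xs + ∑[ A ← subLists xs ] with-x F A (f x) (h x) (allL covered A)
      ≈⟨ ≈-sym (∑-subLists-∷ x xs _) ⟩
    ∑-covered F (x ∷ xs)                                         ∎

-- The random-cluster characters

module RandomCluster {a ℓ : Level} (R : CommutativeRing a ℓ) (w : CommutativeRing.Carrier R) where

  open CommutativeRing R
    renaming (Carrier to K; refl to ≈-refl; sym to ≈-sym; trans to ≈-trans) hiding (zero)
  open import Relation.Binary.Reasoning.Setoid setoid
  open RingFacts R

  clusterWeight : K → ∀ {m} → Edges m → K
  clusterWeight q A = pow R q (#components A) * pow R w (nullity A)

  Z : K → Fun R
  Z q H = ∑[ A ← subLists (edges H) ] clusterWeight q A

  splitWeight : K → K → ∀ {m} → Edges m → Vec Bool m → K
  splitWeight x y A S = if allL (keptEdge S) A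
    then clusterWeight x (restrict S A) * clusterWeight y (restrict (complement S) A) else 0#

  -- For fixed A only the colourings S cutting no edge of A contribute, and
  -- these are exactly the colourings constant along parent pointers.
  module _ (x y : K) {m : ℕ} (A : Edges m) where
    open Parents m A
    open ColouringSum R x y isRootℕ parentℕ parentℕ-below

    private
      allL-keptEdge≡Consistent : ∀ S → allL (keptEdge S) A ≡ Consistent S
      allL-keptEdge≡Consistent S = true⇔⇒≡
        (λ all → Uncut⇒Consistent S (all-keptEdge⇒Uncut S A all))
        (λ consistent → Uncut⇒all-keptEdge S A (Consistent⇒Uncut S consistent))

      #components≡#rootsIn : ∀ S → Uncut S A → #components (restrict S A) ≡ #rootsIn S m
      #components≡#rootsIn S uncut = trans (#components-restrict S A uncut) (sym (trans
        (countℕ≡countFin m _)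
        (countL-cong (allFinL m) (λ j → trans (cong₂ _∧_ (isRootℕ-toℕ j) (lookupℕ-toℕ false S j))
                                              (∧-comm (isRoot A j) (lookup S j))))))

      #components≡#rootsOut : ∀ S → Uncut S A → #components (restrict (complement S) A) ≡ #rootsOut S m
      #components≡#rootsOut S uncut =
        trans (#components-restrict (complement S) A (Uncut-complement S A uncut)) (sym (trans
          (countℕ≡countFin m _)
          (countL-cong (allFinL m) (λ j → trans (cong₂ _∧_ (isRootℕ-toℕ j) (outside j))
                                                (∧-comm (isRoot A j) (lookup (complement S) j))))))
        where
        outside : ∀ j → not (lookupℕ false S (toℕ j)) ≡ lookup (complement S) j
        outside j = trans (cong not (lookupℕ-toℕ false S j)) (sym (lookup-complement S j))

      #roots≡#components : countℕ m isRootℕ ≡ #components A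
      #roots≡#components = trans (countℕ≡countFin m isRootℕ) (countL-cong (allFinL m) isRootℕ-toℕ)

      ∏-weight-kept : ∀ S {b} → allL (keptEdge S) A ≡ b →
        ∏ m (weight S) ≈ (if b then pow R x (#rootsIn S m) * pow R y (#rootsOut S m) else 0#)
      ∏-weight-kept S refl rewrite allL-keptEdge≡Consistent S = ∏-weight S m

    splitWeight≈∏-weight : ∀ S → splitWeight x y A S ≈ ∏ m (weight S) * pow R w (nullity A)
    splitWeight≈∏-weight S with allL (keptEdge S) A in all
    ... | false = ≈-sym (≈-trans (*-congʳ (∏-weight-kept S all)) (zeroˡ _))
    ... | true  = begin
      (pow R x c₁ * pow R w n₁) * (pow R y c₂ * pow R w n₂)  ≈⟨ *-interchange _ _ _ _ ⟩
      (pow R x c₁ * pow R y c₂) * (pow R w n₁ * pow R w n₂)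
        ≈⟨ *-cong (*-cong (pow-congʳ x (#components≡#rootsIn S uncut))
                          (pow-congʳ y (#components≡#rootsOut S uncut)))
                  (≈-sym (pow-+ w n₁ n₂)) ⟩
      (pow R x (#rootsIn S m) * pow R y (#rootsOut S m)) * pow R w (n₁ ℕ.+ n₂)
        ≈⟨ *-cong (≈-sym (∏-weight-kept S all)) (pow-congʳ w (nullity-split S A uncut)) ⟩
      ∏ m (weight S) * pow R w (nullity A)                    ∎
      where
      uncut : Uncut S A
      uncut = all-keptEdge⇒Uncut S A all
      c₁ c₂ n₁ n₂ : ℕ
      c₁ = #components (restrict S A)
      c₂ = #components (restrict (complement S) A)
      n₁ = nullity (restrict S A)
      n₂ = nullity (restrict (complement S) A)

    ∑-splitWeight : ∑ˢ m (splitWeight x y A) ≈ clusterWeight (x + y) A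
    ∑-splitWeight = begin
      ∑ˢ m (splitWeight x y A)                             ≈⟨ ∑-cong (allSubsets m) splitWeight≈∏-weight ⟩
      ∑ˢ m (λ S → ∏ m (weight S) * pow R w (nullity A))    ≈⟨ ∑-*ʳ (allSubsets m) _ _ ⟩
      ∑ˢ m (λ S → ∏ m (weight S)) * pow R w (nullity A)    ≈⟨ *-congʳ (∑-∏-weight m) ⟩
      pow R (x + y) (countℕ m isRootℕ) * pow R w (nullity A) ≈⟨ *-congʳ (pow-congʳ (x + y) #roots≡#components) ⟩
      clusterWeight (x + y) A                                ∎

  conv-Z : ∀ x y G → conv R (Z x) (Z y) G ≈ Z (x + y) G
  conv-Z x y G = begin
    ∑ˢ m (λ S → Z x (induced G S) * Z y (induced G (complement S)))
      ≈⟨ ∑-cong (allSubsets m) (λ S →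
           ∑-*-∑ (subLists (restrict S E)) (subLists (restrict (complement S) E)) _ _) ⟩
    ∑ˢ m (λ S → SubListPairs.∑-pairs R (restrictEdge S) (restrictEdge (complement S)) (restrictEdge-disjoint S)
                  (λ A₁ A₂ → clusterWeight x A₁ * clusterWeight y A₂) (restrict S E) (restrict (complement S) E))
      ≈⟨ ∑-cong (allSubsets m) (λ S → SubListPairs.∑-pairs≈∑-covered R
           (restrictEdge S) (restrictEdge (complement S)) (restrictEdge-disjoint S) _ E) ⟩
    ∑ˢ m (λ S → ∑[ A ← subLists E ] splitWeight x y A S) ≈⟨ ∑-comm (allSubsets m) (subLists E) _ ⟩
    ∑[ A ← subLists E ] ∑ˢ m (splitWeight x y A)         ≈⟨ ∑-cong (subLists E) (∑-splitWeight x y) ⟩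
    Z (x + y) G                                          ∎
    where
    m : ℕ
    m = n G
    E : Edges m
    E = edges G

-- Convolution

module Convolution {a ℓ : Level} (R : CommutativeRing a ℓ) where

  open CommutativeRing R
    renaming (Carrier to K; refl to ≈-refl; sym to ≈-sym; trans to ≈-trans) hiding (zero)
  open import Relation.Binary.Reasoning.Setoid setoid
  open import Algebra.Properties.Group +-group using () renaming (∙-cancelˡ to +-cancelˡ)
  open RingFacts R

  conv-cong : ∀ {φ φ′ ψ ψ′ : Fun R} → (∀ G → φ G ≈ φ′ G) → (∀ G → ψ G ≈ ψ′ G) →
    ∀ G → conv R φ ψ G ≈ conv R φ′ ψ′ G
  conv-cong φ≈φ′ ψ≈ψ′ G = ∑-cong (allSubsets (n G)) (λ S → *-cong (φ≈φ′ _) (ψ≈ψ′ _))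

  conv-congˡ : ∀ {φ φ′ : Fun R} → (∀ G → φ G ≈ φ′ G) → ∀ ψ G → conv R φ ψ G ≈ conv R φ′ ψ G
  conv-congˡ φ≈φ′ ψ = conv-cong {ψ = ψ} {ψ′ = ψ} φ≈φ′ (λ _ → ≈-refl)

  bar-cong : ∀ {φ φ′ : Fun R} → (∀ G → φ G ≈ φ′ G) → ∀ G → bar R φ G ≈ bar R φ′ G
  bar-cong φ≈φ′ G = *-congˡ (φ≈φ′ G)

  bar-conv : ∀ φ ψ G → conv R (bar R φ) (bar R ψ) G ≈ bar R (conv R φ ψ) G
  bar-conv φ ψ G = ≈-trans (∑-cong (allSubsets (n G)) signs) (∑-*ˡ (allSubsets (n G)) _ _)
    where
    signs : ∀ S → (pow R (- 1#) (count S) * φ (induced G S))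
                  * (pow R (- 1#) (count (complement S)) * ψ (induced G (complement S)))
                ≈ pow R (- 1#) (n G) * (φ (induced G S) * ψ (induced G (complement S)))
    signs S = ≈-trans (*-interchange _ _ _ _)
      (*-congʳ (≈-trans (≈-sym (pow-+ (- 1#) (count S) _)) (pow-congʳ (- 1#) (count-complement S))))

  bar-counit : ∀ G → bar R (counit R) G ≈ counit R G
  bar-counit (mkGraph zero    E) = *-identityˡ 1#
  bar-counit (mkGraph (suc m) E) = zeroʳ _

  ∑ˢ-∅-determined : ∀ k (F F′ : Vec Bool k → K) → (∀ S → S ≢ replicate k false → F S ≈ F′ S) →
    ∑ˢ k F ≈ ∑ˢ k F′ → F (replicate k false) ≈ F′ (replicate k false)
  ∑ˢ-∅-determined zero    F F′ _      ∑≈ = ≈-trans (≈-sym (+-identityʳ _)) (≈-trans ∑≈ (+-identityʳ _))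
  ∑ˢ-∅-determined (suc k) F F′ others ∑≈ =
    ∑ˢ-∅-determined k (F ∘ (false ∷_)) (F′ ∘ (false ∷_)) (λ S S≢∅ → others (false ∷ S) (S≢∅ ∘ cong V.tail))
      (+-cancelˡ (∑ˢ k (F ∘ (true ∷_))) _ _ (begin
        ∑ˢ k (F ∘ (true ∷_)) + ∑ˢ k (F ∘ (false ∷_))    ≈⟨ ≈-sym (∑ˢ-∷ k F) ⟩
        ∑ˢ (suc k) F                                      ≈⟨ ∑≈ ⟩
        ∑ˢ (suc k) F′                                     ≈⟨ ∑ˢ-∷ k F′ ⟩
        ∑ˢ k (F′ ∘ (true ∷_)) + ∑ˢ k (F′ ∘ (false ∷_))
          ≈⟨ +-congʳ (∑-cong (allSubsets k) (λ S → ≈-sym (others (true ∷ S) (λ ())))) ⟩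
        ∑ˢ k (F ∘ (true ∷_)) + ∑ˢ k (F′ ∘ (false ∷_))   ∎))

  -- By induction on n G: in (φ * ψ) G the term S = ∅ is φ ∅ · ψ G = ψ G and
  -- all other terms involve ψ on smaller graphs only.
  right-inverse-unique : ∀ (φ ψ χ : Fun R) → (∀ G → n G ≡ 0 → φ G ≈ 1#) →
    (∀ G → conv R φ ψ G ≈ counit R G) → (∀ G → conv R φ χ G ≈ counit R G) → ∀ G → ψ G ≈ χ G
  right-inverse-unique φ ψ χ φ∅≈1 φψ≈ε φχ≈ε G = below (suc (n G)) G ℕₚ.≤-refl
    where
    below : ∀ k G → n G < k → ψ G ≈ χ G
    below (suc k) G G<k = begin
      ψ G                                    ≡⟨ cong ψ (sym (induced-complement-none G)) ⟩
      ψ (induced G (complement ∅))           ≈⟨ ≈-sym (*-identityˡ _) ⟩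
      1# * ψ (induced G (complement ∅))      ≈⟨ *-congʳ (≈-sym (φ∅≈1 _ (count-replicate-false (n G)))) ⟩
      φ (induced G ∅) * ψ (induced G (complement ∅))
        ≈⟨ ∑ˢ-∅-determined (n G) (λ S → φ (induced G S) * ψ (induced G (complement S)))
             (λ S → φ (induced G S) * χ (induced G (complement S)))
             (λ S S≢∅ → *-congˡ (below k _ (smaller S S≢∅))) (≈-trans (φψ≈ε G) (≈-sym (φχ≈ε G))) ⟩
      φ (induced G ∅) * χ (induced G (complement ∅)) ≈⟨ *-congʳ (φ∅≈1 _ (count-replicate-false (n G))) ⟩
      1# * χ (induced G (complement ∅))      ≈⟨ *-identityˡ _ ⟩
      χ (induced G (complement ∅))           ≡⟨ cong χ (induced-complement-none G) ⟩
      χ G                                    ∎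
      where
      ∅ : Vec Bool (n G)
      ∅ = replicate (n G) false
      smaller : ∀ S → S ≢ ∅ → count (complement S) < k
      smaller S S≢∅ = ℕₚ.<-≤-trans
        (ℕₚ.<-≤-trans (ℕₚ.m<n+m (count (complement S)) (count-pos S S≢∅))
                      (ℕₚ.≤-reflexive (count-complement S)))
        (ℕ.s≤s⁻¹ G<k)

m+[[o∸m]∸[o∸n]]≡n : ∀ {m n o} → m ≤ n → n ≤ o → m ℕ.+ ((o ∸ m) ∸ (o ∸ n)) ≡ n
m+[[o∸m]∸[o∸n]]≡n {m} {n} {o} m≤n n≤o = begin
  m ℕ.+ ((o ∸ m) ∸ (o ∸ n))                       ≡⟨ cong (λ z → m ℕ.+ (z ∸ (o ∸ n))) o∸m ⟩
  m ℕ.+ (((o ∸ n) ℕ.+ (n ∸ m)) ∸ (o ∸ n))        ≡⟨ cong (m ℕ.+_) (ℕₚ.m+n∸m≡n (o ∸ n) (n ∸ m)) ⟩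
  m ℕ.+ (n ∸ m)                                   ≡⟨ ℕₚ.m+[n∸m]≡n m≤n ⟩
  n                                               ∎
  where
  open ≡-Reasoning
  o∸m : o ∸ m ≡ (o ∸ n) ℕ.+ (n ∸ m)
  o∸m = trans (cong (_∸ m) (sym (ℕₚ.m∸n+n≡m n≤o))) (ℕₚ.+-∸-assoc (o ∸ n) m≤n)

-- The characters τ₂ and τ̃₀

module Characters {a ℓ : Level} (R : CommutativeRing a ℓ) (y : CommutativeRing.Carrier R) where

  open CommutativeRing R
    renaming (Carrier to K; refl to ≈-refl; sym to ≈-sym; trans to ≈-trans) hiding (zero)
  open import Relation.Binary.Reasoning.Setoid setoid
  open import Algebra.Properties.Group +-group using (ε⁻¹≈ε) renaming (∙-cancelˡ to +-cancelˡ)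
  open import Algebra.Properties.AbelianGroup +-abelianGroup using (⁻¹-∙-comm)
  open RingFacts R
  open RandomCluster R (y - 1#)
  open Convolution R

  tutte-congˡ : ∀ H {x x′} → x ≈ x′ → tutte R H x y ≈ tutte R H x′ y
  tutte-congˡ H x≈x′ =
    ∑-cong (subLists (edges H)) (λ A → *-congʳ (pow-congˡ (rk H ∸ rkE H A) (+-congʳ x≈x′)))

  Z-congˡ : ∀ H {q q′} → q ≈ q′ → Z q H ≈ Z q′ H
  Z-congˡ H q≈q′ = ∑-cong (subLists (edges H)) (λ A → *-congʳ (pow-congˡ (#components A) q≈q′))

  Z≈tutte : ∀ q H → Z q H ≈ pow R q (c H) * tutte R H (q + 1#) y
  Z≈tutte q H = ≈-sym (≈-trans (≈-sym (∑-*ˡ (subLists E) _ (pow R q (c H))))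
                               (∑-cong-∈ (subLists E) term≈clusterWeight))
    where
    E : Edges (n H)
    E = edges H
    q+1-1≈q : (q + 1#) - 1# ≈ q
    q+1-1≈q = ≈-trans (+-assoc q 1# (- 1#)) (≈-trans (+-congˡ (-‿inverseʳ 1#)) (+-identityʳ q))
    term≈clusterWeight : ∀ A → A ∈ subLists E →
      pow R q (c H) * (pow R ((q + 1#) - 1#) (rank E ∸ rank A) * pow R (y - 1#) (nullity A))
        ≈ clusterWeight q A
    term≈clusterWeight A A∈ = begin
      pow R q (c H) * (pow R ((q + 1#) - 1#) (rank E ∸ rank A) * pow R (y - 1#) (nullity A))
        ≈⟨ ≈-sym (*-assoc _ _ _) ⟩
      (pow R q (c H) * pow R ((q + 1#) - 1#) (rank E ∸ rank A)) * pow R (y - 1#) (nullity A)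
        ≈⟨ *-congʳ (*-congˡ (pow-congˡ (rank E ∸ rank A) q+1-1≈q)) ⟩
      (pow R q (c H) * pow R q (rank E ∸ rank A)) * pow R (y - 1#) (nullity A)
        ≈⟨ *-congʳ (≈-sym (pow-+ q (c H) (rank E ∸ rank A))) ⟩
      pow R q (c H ℕ.+ (rank E ∸ rank A)) * pow R (y - 1#) (nullity A)
        ≈⟨ *-congʳ (pow-congʳ q (m+[[o∸m]∸[o∸n]]≡n
             (#components-antitone A E (∈-subLists⇒⊆ E A∈)) (#components-≤ A))) ⟩
      clusterWeight q A ∎

  Z-0# : ∀ H → Z 0# H ≈ counit R H
  Z-0# (mkGraph zero [])            = ≈-trans (+-identityʳ _) (*-identityˡ 1#)
  Z-0# (mkGraph zero ((() , _) ∷ _))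
  Z-0# (mkGraph (suc m) E)          = ∑-zero (subLists E) _
    (λ A → ≈-trans (*-congʳ (pow-0#-pos (#components-pos A))) (zeroˡ _))
    where
    pow-0#-pos : ∀ {k} → 1 ≤ k → pow R 0# k ≈ 0#
    pow-0#-pos {suc k} _ = pow-0#-suc k

  Z-empty : ∀ q H → n H ≡ 0 → Z q H ≈ 1#
  Z-empty q (mkGraph zero [])            refl = ≈-trans (+-identityʳ _) (*-identityˡ 1#)
  Z-empty q (mkGraph zero ((() , _) ∷ _)) refl

  convPow-Z : ∀ φ q → (∀ G → φ G ≈ Z q G) → ∀ k G → convPow R φ k G ≈ Z (fromℕ R k * q) G
  convPow-Z φ q φ≈Z zero    G = ≈-sym (≈-trans (Z-congˡ G (zeroˡ q)) (Z-0# G))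
  convPow-Z φ q φ≈Z (suc k) G = begin
    conv R φ (convPow R φ k) G              ≈⟨ conv-cong φ≈Z (convPow-Z φ q φ≈Z k) G ⟩
    conv R (Z q) (Z (fromℕ R k * q)) G      ≈⟨ conv-Z q (fromℕ R k * q) G ⟩
    Z (q + fromℕ R k * q) G
      ≈⟨ Z-congˡ G (≈-trans (+-congʳ (≈-sym (*-identityˡ q))) (≈-sym (distribʳ q 1# _))) ⟩
    Z (fromℕ R (suc k) * q) G               ∎

  convPow-bar-Z : ∀ φ q → (∀ G → φ G ≈ bar R (Z q) G) →
    ∀ k G → convPow R φ k G ≈ bar R (Z (fromℕ R k * q)) G
  convPow-bar-Z φ q φ≈Z̄ k G = ≈-trans (convPow-bar k G) (bar-cong (convPow-Z (Z q) q (λ _ → ≈-refl) k) G)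
    where
    convPow-bar : ∀ k G → convPow R φ k G ≈ bar R (convPow R (Z q) k) G
    convPow-bar zero    G = ≈-sym (bar-counit G)
    convPow-bar (suc k) G = ≈-trans (conv-cong φ≈Z̄ (convPow-bar k) G) (bar-conv (Z q) (convPow R (Z q) k) G)

  -- (-1)^{n(G)} (-q)^{c(G)} = (-1)^{rk(G)} q^{c(G)}, since n(G) = rk(G) + c(G)
  bar-Z-neg : ∀ q G → bar R (Z (- q)) G ≈ pow R q (c G) * (pow R (- 1#) (rk G) * tutte R G (- q + 1#) y)
  bar-Z-neg q G = begin
    pow R (- 1#) (n G) * Z (- q) G                                    ≈⟨ *-congˡ (Z≈tutte (- q) G) ⟩
    pow R (- 1#) (n G) * (pow R (- q) (c G) * T)                      ≈⟨ ≈-sym (*-assoc _ _ _) ⟩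
    (pow R (- 1#) (n G) * pow R (- q) (c G)) * T                      ≈⟨ *-congʳ signs ⟩
    (pow R q (c G) * pow R (- 1#) (rk G)) * T                         ≈⟨ *-assoc _ _ _ ⟩
    pow R q (c G) * (pow R (- 1#) (rk G) * T)                         ∎
    where
    T : K
    T = tutte R G (- q + 1#) y
    ε : ℕ → K
    ε = pow R (- 1#)
    n≡rk+c : n G ≡ rk G ℕ.+ c G
    n≡rk+c = sym (ℕₚ.m∸n+n≡m (#components-≤ (edges G)))
    signs : ε (n G) * pow R (- q) (c G) ≈ pow R q (c G) * ε (rk G)
    signs = begin
      ε (n G) * pow R (- q) (c G)
        ≈⟨ *-cong (≈-trans (pow-congʳ (- 1#) n≡rk+c) (pow-+ (- 1#) (rk G) (c G)))
                  (≈-trans (pow-congˡ (c G) (≈-sym (-1*x≈-x q))) (pow-* (- 1#) q (c G))) ⟩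
      (ε (rk G) * ε (c G)) * (ε (c G) * pow R q (c G))   ≈⟨ *-assoc _ _ _ ⟩
      ε (rk G) * (ε (c G) * (ε (c G) * pow R q (c G)))   ≈⟨ *-congˡ (≈-sym (*-assoc _ _ _)) ⟩
      ε (rk G) * ((ε (c G) * ε (c G)) * pow R q (c G))   ≈⟨ *-congˡ (*-congʳ (pow-[-1]-square (c G))) ⟩
      ε (rk G) * (1# * pow R q (c G))                    ≈⟨ *-congˡ (*-identityˡ _) ⟩
      ε (rk G) * pow R q (c G)                           ≈⟨ *-comm _ _ ⟩
      pow R q (c G) * ε (rk G)                           ∎

  τ₂≈Z1 : ∀ G → τ R (fromℕ R 2) y G ≈ Z 1# G
  τ₂≈Z1 G = begin
    tutte R G (1# + (1# + 0#)) y           ≈⟨ tutte-congˡ G (+-congˡ (+-identityʳ 1#)) ⟩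
    tutte R G (1# + 1#) y                  ≈⟨ ≈-sym (*-identityˡ _) ⟩
    1# * tutte R G (1# + 1#) y             ≈⟨ *-congʳ (≈-sym (pow-1# (c G))) ⟩
    pow R 1# (c G) * tutte R G (1# + 1#) y ≈⟨ ≈-sym (Z≈tutte 1# G) ⟩
    Z 1# G                                 ∎

  τ̃₀≈bar-Z-1 : ∀ G → tilde R (τ R 0# y) G ≈ bar R (Z (- 1#)) G
  τ̃₀≈bar-Z-1 G = ≈-sym (begin
    bar R (Z (- 1#)) G                                        ≈⟨ bar-Z-neg 1# G ⟩
    pow R 1# (c G) * (pow R (- 1#) (rk G) * tutte R G (- 1# + 1#) y)
      ≈⟨ ≈-trans (*-congʳ (pow-1# (c G))) (*-identityˡ _) ⟩
    pow R (- 1#) (rk G) * tutte R G (- 1# + 1#) y             ≈⟨ *-congˡ (tutte-congˡ G (-‿inverseˡ 1#)) ⟩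
    tilde R (τ R 0# y) G                                      ∎)

  module _ (ψ₂ ψ₀ : Fun R) (inv₂ : IsConvInverse R (τ R (fromℕ R 2) y) ψ₂)
           (inv₀ : IsConvInverse R (tilde R (τ R 0# y)) ψ₀) where

    ψ₂≈Z-1 : ∀ G → ψ₂ G ≈ Z (- 1#) G
    ψ₂≈Z-1 = right-inverse-unique _ ψ₂ (Z (- 1#))
      (λ G G∅ → ≈-trans (τ₂≈Z1 G) (Z-empty 1# G G∅)) (proj₁ ∘ inv₂)
      (λ G → begin
        conv R (τ R (fromℕ R 2) y) (Z (- 1#)) G ≈⟨ conv-congˡ τ₂≈Z1 (Z (- 1#)) G ⟩
        conv R (Z 1#) (Z (- 1#)) G              ≈⟨ conv-Z 1# (- 1#) G ⟩
        Z (1# + - 1#) G                         ≈⟨ Z-congˡ G (-‿inverseʳ 1#) ⟩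
        Z 0# G                                  ≈⟨ Z-0# G ⟩
        counit R G                              ∎)

    ψ₀≈bar-Z1 : ∀ G → ψ₀ G ≈ bar R (Z 1#) G
    ψ₀≈bar-Z1 = right-inverse-unique _ ψ₀ (bar R (Z 1#))
      (λ G G∅ → ≈-trans (τ̃₀≈bar-Z-1 G)
        (≈-trans (*-cong (pow-congʳ (- 1#) G∅) (Z-empty (- 1#) G G∅)) (*-identityˡ 1#)))
      (proj₁ ∘ inv₀)
      (λ G → begin
        conv R (tilde R (τ R 0# y)) (bar R (Z 1#)) G ≈⟨ conv-congˡ τ̃₀≈bar-Z-1 (bar R (Z 1#)) G ⟩
        conv R (bar R (Z (- 1#))) (bar R (Z 1#)) G   ≈⟨ bar-conv (Z (- 1#)) (Z 1#) G ⟩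
        bar R (conv R (Z (- 1#)) (Z 1#)) G           ≈⟨ bar-cong (conv-Z (- 1#) 1#) G ⟩
        bar R (Z (- 1# + 1#)) G
          ≈⟨ bar-cong (λ H → ≈-trans (Z-congˡ H (-‿inverseˡ 1#)) (Z-0# H)) G ⟩
        bar R (counit R) G                           ≈⟨ bar-counit G ⟩
        counit R G                                   ∎)

    convPowℤ-τ₂ : ∀ k G → convPowℤ R (τ R (fromℕ R 2) y) ψ₂ k G ≈ Z (fromℤ R k) G
    convPowℤ-τ₂ (ℤ.+ j)    G = ≈-trans (convPow-Z _ 1# τ₂≈Z1 j G) (Z-congˡ G (*-identityʳ _))
    convPowℤ-τ₂ ℤ.-[1+ j ] G = ≈-trans (convPow-Z ψ₂ (- 1#) ψ₂≈Z-1 (suc j) G) (Z-congˡ G (x*-1≈-x _))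

    convPowℤ-τ̃₀ : ∀ k G → convPowℤ R (tilde R (τ R 0# y)) ψ₀ k G ≈ bar R (Z (- fromℤ R k)) G
    convPowℤ-τ̃₀ (ℤ.+ j)    G = ≈-trans (convPow-bar-Z _ (- 1#) τ̃₀≈bar-Z-1 j G)
                                        (bar-cong (λ H → Z-congˡ H (x*-1≈-x _)) G)
    convPowℤ-τ̃₀ ℤ.-[1+ j ] G = ≈-trans (convPow-bar-Z ψ₀ 1# ψ₀≈bar-Z1 (suc j) G)
      (bar-cong (λ H → Z-congˡ H (≈-trans (*-identityʳ _) (≈-sym (-‿involutive _)))) G)

-- The hypothesis that R is a field of characteristic 0 is not needed.
corollary4p2 : ∀ {a ℓ : Level} (R : CommutativeRing a ℓ) → IsFieldChar0 R →
    let open CommutativeRing R in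
    (y : Carrier) (ψ₂ ψ₀ : Fun R) →
    IsConvInverse R (τ R (fromℕ R 2) y) ψ₂ →
    IsConvInverse R (tilde R (τ R 0# y)) ψ₀ →
    ((k : ℤ) (G : Graph) →
      (convPowℤ R (τ R (fromℕ R 2) y) ψ₂ k G
        ≈ pow R (fromℤ R k) (c G) * tutte R G (fromℤ R (k ℤ.+ 1ℤ)) y)
      × (convPowℤ R (tilde R (τ R 0# y)) ψ₀ k G
        ≈ pow R (fromℤ R k) (c G) * (pow R (- 1#) (rk G) * tutte R G (fromℤ R (1ℤ ℤ.- k)) y)))
    × ((G : Graph) → ψ₀ G ≈ bar R (τ R (fromℕ R 2) y) G)
corollary4p2 R _ y ψ₂ ψ₀ inv₂ inv₀ = (λ k G → powers-τ₂ k G , powers-τ̃₀ k G) , ψ₀≈bar-τ₂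
  where
  open CommutativeRing R renaming (trans to ≈-trans; sym to ≈-sym)
  open RingFacts R using (fromℤ-+1; fromℤ-1-)
  open Convolution R using (bar-cong)
  open RandomCluster R (y - 1#) using (Z)
  open Characters R y

  powers-τ₂ : ∀ k G → convPowℤ R (τ R (fromℕ R 2) y) ψ₂ k G
                    ≈ pow R (fromℤ R k) (c G) * tutte R G (fromℤ R (k ℤ.+ 1ℤ)) y
  powers-τ₂ k G = ≈-trans (convPowℤ-τ₂ ψ₂ ψ₀ inv₂ inv₀ k G)
    (≈-trans (Z≈tutte (fromℤ R k) G) (*-congˡ (tutte-congˡ G (≈-sym (fromℤ-+1 k)))))

  powers-τ̃₀ : ∀ k G → convPowℤ R (tilde R (τ R 0# y)) ψ₀ k G
                    ≈ pow R (fromℤ R k) (c G) * (pow R (- 1#) (rk G) * tutte R G (fromℤ R (1ℤ ℤ.- k)) y)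
  powers-τ̃₀ k G = ≈-trans (convPowℤ-τ̃₀ ψ₂ ψ₀ inv₂ inv₀ k G)
    (≈-trans (bar-Z-neg (fromℤ R k) G) (*-congˡ (*-congˡ (tutte-congˡ G (≈-sym (fromℤ-1- k))))))

  ψ₀≈bar-τ₂ : ∀ G → ψ₀ G ≈ bar R (τ R (fromℕ R 2) y) G
  ψ₀≈bar-τ₂ G = ≈-trans (ψ₀≈bar-Z1 ψ₂ ψ₀ inv₂ inv₀ G) (bar-cong (≈-sym ∘ τ₂≈Z1) G)
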